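{- Let $(G,X,H)$ be an uncolorable degree-feasible configuration. Then: (a) $|X_v|=d_G(v)$ for all $v\in V(G)$; (b) for each vertex $z$ of $G$ that is not a separating vertex, each vertex $v\ne z$ of $G$, and each $x\in X_z$, we have $|N_H(x)\cap X_v|=\mu_G(v,z)$; (c) every hyperedge $e$ of $G$ is a bridge of $G$, hence $\langle e\rangle$ is a block of $G$, and consequently $G$ has no parallel hyperedges; (d) if $G$ is a block (has no separating vertex), then $G$ is regular and for distinct vertices $u,v$ of $G$, $H[X_u\cup X_v]$ is a $\mu_G(u,v)$-regular bipartite graph with parts $X_u$ and $X_v$; (e) for each vertex $v\in V(G)$ there is an independent set $T$ of $H$ with $|T\cap X_u|=1$ for all $u\in V(G)\setminus\{v\}$.
   Context: Hypergraph $G=(V,E,i)$: finite vertex and edge sets, $i:E\to2^V$ with $|i(e)|\ge2$, parallel edges allowed (edges $e\neq e'$ with $i(e)=i(e')$). An edge is a hyperedge if $|i(e)|\ge3$. $d_G(v)$ is the number of edges containing $v$; $G$ is regular if all degrees are equal. $\mu_G(u,v)$ is the number of edges $e$ with $i_G(e)=\{u,v\}$. $G[Y]$ is the induced subhypergraph on $Y$; $Y$ is independent if $G[Y]$ has no edges. $N_H(x)$ is the set of vertices $y$ such that some edge $e$ of $H$ has $i_H(e)=\{x,y\}$. $G$ is connected if any two vertices are joined by a sequence of distinct vertices $v_1,\dots,v_{q+1}$ and distinct edges $e_1,\dots,e_q$ with $\{v_j,v_{j+1}\}\subseteq i(e_j)$; components are maximal connected subhypergraphs. An edge $e$ is a bridge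 if $G-e$ has $|i_G(e)|-1$ more components than $G$. A separating vertex $v$: $G$ is the union of two induced subhypergraphs $G_1,G_2$ with $V(G_1)\cap V(G_2)=\{v\}$ and $|V(G_i)|\ge2$; a block is a maximal connected subhypergraph with no separating vertex. $\langle e\rangle$ denotes the hypergraph with the single edge $e$ and vertex set $i(e)$. A cover of $G$ is a pair $(X,H)$: $X$ assigns pairwise disjoint sets $X_v$ to $v\in V(G)$; $H$ is a hypergraph with $V(H)=\bigcup_vX_v$, each $X_v$ independent in $H$, and for each $e\in E(G)$ a possibly empty matching $M_e$ in $H[\bigcup_{v\in i_G(e)}X_v]$ whose edges meet each $X_v$, $v\in i_G(e)$, in exactly one vertex, with $E(H)=\bigcup_eM_e$. A feasible configuration is $(G,X,H)$ with $G$ connected and $(X,H)$ a cover of $G$; degree-feasible if $|X_v|\ge d_G(v)$ for all $v$; uncolorable if there is no independent set $T$ of $H$ with $|T\cap X_v|=1$ for every $v$. -}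

module Defs where

open import Data.Nat using (ℕ; _≤_; _∸_; _+_)
open import Data.Bool using (Bool; _∧_)
import Data.Bool as Bool
open import Data.Fin using (Fin)
import Data.Fin as Fin
open import Data.Fin.Properties using (any?)
open import Data.Fin.Subset using (Subset; _∈_; _⊆_; ⁅_⁆; _∪_; _∩_; ⊤; ∣_∣; ∁; Empty)
open import Data.Fin.Subset.Properties using (_⊆?_; _∈?_)
open import Data.Vec using (tabulate; lookup)
open import Data.Vec.Properties using (≡-dec)
open import Data.Product using (Σ; ∃; _×_; _,_)
open import Data.Sum using (_⊎_)
open import Relation.Nullary using (¬_; Dec; does)
open import Relation.Binary.PropositionalEquality using (_≡_; _≢_)
open import Relation.Binary.Construct.Closure.ReflexiveTransitive using (Star)
open import Function.Bundles using (_⇔_)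

infix 4 _≟ₛ_
_≟ₛ_ : ∀ {n} (A B : Subset n) → Dec (A ≡ B)
_≟ₛ_ = ≡-dec Bool._≟_

⟦_⟧ : ∀ {n} → (Fin n → Bool) → Subset n
⟦ p ⟧ = tabulate p

-- Hypergraphs: vertices Fin nV, edges Fin nE, incidence i : E → 2^V,
-- every edge has at least two vertices; parallel edges allowed.

record Hypergraph : Set where
  field
    nV  : ℕ
    nE  : ℕ
    inc : Fin nE → Subset nV
    inc-≥2 : ∀ e → 2 ≤ ∣ inc e ∣
open Hypergraph public

module _ (G : Hypergraph) where

  Vtx : Set
  Vtx = Fin (nV G)

  Edg : Set
  Edg = Fin (nE G)

  IsHyperedge : Edg → Set
  IsHyperedge e = 3 ≤ ∣ inc G e ∣

  edgesAt : Vtx → Subset (nE G)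
  edgesAt v = ⟦ (λ e → does (v ∈? inc G e)) ⟧

  deg : Vtx → ℕ
  deg v = ∣ edgesAt v ∣

  Regular : Set
  Regular = ∀ u v → deg u ≡ deg v

  μ : Vtx → Vtx → ℕ
  μ u v = ∣ ⟦ (λ e → does (inc G e ≟ₛ (⁅ u ⁆ ∪ ⁅ v ⁆))) ⟧ ∣

  Independent : Subset (nV G) → Set
  Independent Y = ∀ e → ¬ (inc G e ⊆ Y)

  N : Vtx → Subset (nV G)
  N x = ⟦ (λ y → does (any? (λ e → inc G e ≟ₛ (⁅ x ⁆ ∪ ⁅ y ⁆)))) ⟧

  record Sub : Set where
    constructor sub
    field
      Ys : Subset (nV G)
      Fs : Subset (nE G)
      closed : ∀ e → e ∈ Fs → inc G e ⊆ Ys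
  open Sub public

  whole : Sub
  whole = sub ⊤ ⊤ (λ e _ _ → Data.Fin.Subset.Properties.∈⊤)

  single : Edg → Sub
  single e = sub (inc G e) ⁅ e ⁆ cl
    where
    cl : ∀ f → f ∈ ⁅ e ⁆ → inc G f ⊆ inc G e
    cl f f∈ rewrite Data.Fin.Subset.Properties.x∈⁅y⁆⇒x≡y e f∈ = λ p → p

  minusEdge : Edg → Sub
  minusEdge e = sub ⊤ (∁ ⁅ e ⁆) (λ _ _ _ → Data.Fin.Subset.Properties.∈⊤)

  _⊑_ : Sub → Sub → Set
  S ⊑ S' = (Ys S ⊆ Ys S') × (Fs S ⊆ Fs S')

  Adj : Sub → Vtx → Vtx → Set
  Adj S u v = ∃ λ e → e ∈ Fs S × u ∈ inc G e × v ∈ inc G e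

  -- u and v are joined by a walk in S (equivalently by a path with
  -- distinct vertices and distinct edges)
  Joined : Sub → Vtx → Vtx → Set
  Joined S = Star (Adj S)

  Connected : Sub → Set
  Connected S = ∀ u v → u ∈ Ys S → v ∈ Ys S → Joined S u v

  -- S has exactly k components: a labelling of the vertices of S by
  -- Fin k which is onto and identifies exactly the joined pairs
  HasComponents : Sub → ℕ → Set
  HasComponents S k =
    Σ (Vtx → Fin k) λ c →
      (∀ j → ∃ λ u → u ∈ Ys S × c u ≡ j) ×
      (∀ u v → u ∈ Ys S → v ∈ Ys S → (c u ≡ c v) ⇔ Joined S u v)

  IsBridge : Edg → Set
  IsBridge e = ∃ λ k → HasComponents whole k
                     × HasComponents (minusEdge e) (k + (∣ inc G e ∣ ∸ 1))

  IsSeparating : Sub → Vtx → Set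
  IsSeparating S v =
    ∃ λ Y₁ → ∃ λ Y₂ →
      (Y₁ ⊆ Ys S) × (Y₂ ⊆ Ys S) × ((Y₁ ∪ Y₂) ≡ Ys S) ×
      ((Y₁ ∩ Y₂) ≡ ⁅ v ⁆) × (2 ≤ ∣ Y₁ ∣) × (2 ≤ ∣ Y₂ ∣) ×
      (∀ e → e ∈ Fs S → (inc G e ⊆ Y₁) ⊎ (inc G e ⊆ Y₂))

  NoSeparating : Sub → Set
  NoSeparating S = ∀ v → ¬ IsSeparating S v

  IsBlock : Sub → Set
  IsBlock S = Connected S × NoSeparating S ×
    (∀ S' → S ⊑ S' → Connected S' → NoSeparating S' →
       (Ys S' ≡ Ys S) × (Fs S' ≡ Fs S))

  NoParallelHyperedges : Set
  NoParallelHyperedges = ∀ e e' → e ≢ e' → IsHyperedge e → IsHyperedge e' →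
                         inc G e ≢ inc G e'

-- The sets X_v are given by a map π : V(H) → V(G)
-- (X_v = π⁻¹(v)); this makes them pairwise disjoint with union V(H).
-- The map φ : E(H) → E(G) says which matching M_e an edge of H belongs to.

record Cover (G : Hypergraph) : Set where
  field
    H : Hypergraph
    π : Fin (nV H) → Fin (nV G)
    φ : Fin (nE H) → Fin (nE G)

  X : Fin (nV G) → Subset (nV H)
  X v = ⟦ (λ x → does (π x Fin.≟ v)) ⟧

  field
    X-indep : ∀ v → Independent H (X v)
    φ-inside : ∀ f x → x ∈ inc H f → π x ∈ inc G (φ f)
    φ-meets : ∀ f v → v ∈ inc G (φ f) → ∣ inc H f ∩ X v ∣ ≡ 1
    φ-matching : ∀ f f' → f ≢ f' → φ f ≡ φ f' → Empty (inc H f ∩ inc H f')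
open Cover public

record Configuration : Set where
  field
    G : Hypergraph
    cov : Cover G
    connected : Connected G (whole G)
open Configuration public

module _ (C : Configuration) where
  private
    G' = G C
    H' = H (cov C)
    X' = X (cov C)

  DegreeFeasible : Set
  DegreeFeasible = ∀ v → deg G' v ≤ ∣ X' v ∣

  Uncolorable : Set
  Uncolorable = ¬ (∃ λ T → Independent H' T × (∀ v → ∣ T ∩ X' v ∣ ≡ 1))

RegularBipartite : (H : Hypergraph) → ℕ → Subset (nV H) → Subset (nV H) → Set
RegularBipartite H k A B =
  Empty (A ∩ B) ×
  (∀ f → inc H f ⊆ (A ∪ B) →
     (∣ inc H f ∣ ≡ 2) × (∣ inc H f ∩ A ∣ ≡ 1) × (∣ inc H f ∩ B ∣ ≡ 1)) ×
  (∀ x → x ∈ (A ∪ B) →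
     ∣ ⟦ (λ f → does (inc H f ⊆? (A ∪ B)) ∧ does (x ∈? inc H f)) ⟧ ∣ ≡ k)

module Submission where

open import Defs
open import Data.Nat using (ℕ; zero; suc; _+_; _∸_; _≤_; _<_; _<?_; _≤?_; z≤n; s≤s)
open import Data.Nat.Properties hiding (_≟_)
open import Data.Bool using (Bool; true; false; _∧_)
open import Data.Fin using (Fin; zero; suc; _≟_)
import Data.Fin.Properties as FinP
open import Data.Fin.Subset
open import Data.Fin.Subset.Properties
open import Data.Vec using ([]; _∷_; tabulate)
open import Data.Vec.Properties using (lookup∘tabulate; []=⇒lookup; lookup⇒[]=)
open import Data.Vec.Base using (here; there)
open import Data.Product using (Σ; ∃; _×_; _,_; proj₁; proj₂)
open import Data.Sum using (_⊎_; inj₁; inj₂; [_,_]′)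
open import Data.Empty renaming (⊥ to Void) using (⊥-elim)
open import Relation.Nullary using (¬_; Dec; yes; no; does; ¬?)
open import Relation.Nullary.Decidable using (_×-dec_; _→-dec_; dec-true; toSum; decidable-stable)
open import Relation.Binary.PropositionalEquality using (_≡_; _≢_; refl; sym; trans; cong; cong₂; subst; module ≡-Reasoning)
open import Relation.Binary.Construct.Closure.ReflexiveTransitive using (Star; ε; _◅_; _◅◅_)
import Relation.Binary.Construct.Closure.ReflexiveTransitive as Star
open import Function.Bundles using (_⇔_; mk⇔)

-- A partial
-- colouring of P ⊆ V(G) is an independent set T of H with one vertex in
-- X_v for each v ∈ P.  For u ∉ P, a vertex y ∈ X_u can join T unless an
-- edge of H lies in T ∪ {y}; distinct such blocked y are blocked through
-- distinct matchings M_e with e ∋ u inside P ∪ {u} ("full" edges).  As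
-- |X_u| ≥ d(u), u can be coloured once some edge at u has another
-- uncoloured vertex, so colouring in order of decreasing distance to a set
-- of roots colours everything but the roots (colour-towards).
-- (e) and (a): colour all but v; with |X_v| > d(v), v could be coloured too.
-- (b): start from x ∈ X_z and colour towards v; if x had fewer than μ(v,z)
-- neighbours in X_v, counting at v would again colour v.  (c): a walk in
-- G − e between two vertices of a hyperedge e allows colouring around e
-- (module Detour); hence e is a bridge and ⟨e⟩ a block.  (d): in a block,
-- (b) holds for all pairs, and counting matching edges gives the rest.

from-does : ∀ {a} {P : Set a} (d : Dec P) → does d ≡ true → P
from-does (yes p) _ = p
from-does (no _) ()

∧-true⁻ : ∀ {a b} → a ∧ b ≡ true → (a ≡ true) × (b ≡ true)
∧-true⁻ {true} e = refl , e

∧-true⁺ : ∀ {a b} → a ≡ true → b ≡ true → a ∧ b ≡ true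
∧-true⁺ refl refl = refl

∈⟦⟧⁻ : ∀ {n} {p : Fin n → Bool} {x} → x ∈ ⟦ p ⟧ → p x ≡ true
∈⟦⟧⁻ {p = p} {x} m = trans (sym (lookup∘tabulate p x)) ([]=⇒lookup m)

∈⟦⟧⁺ : ∀ {n} {p : Fin n → Bool} {x} → p x ≡ true → x ∈ ⟦ p ⟧
∈⟦⟧⁺ {p = p} {x} e = lookup⇒[]= x (tabulate p) (trans (lookup∘tabulate p x) e)

∈⟦d⟧⁻ : ∀ {n} {P : Fin n → Set} {d : ∀ x → Dec (P x)} {x} → x ∈ ⟦ (λ y → does (d y)) ⟧ → P x
∈⟦d⟧⁻ {d = d} {x} m = from-does (d x) (∈⟦⟧⁻ m)

∈⟦d⟧⁺ : ∀ {n} {P : Fin n → Set} {d : ∀ x → Dec (P x)} {x} → P x → x ∈ ⟦ (λ y → does (d y)) ⟧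
∈⟦d⟧⁺ {d = d} {x} p = ∈⟦⟧⁺ (dec-true (d x) p)

∈∪ˡ : ∀ {n} {p q : Subset n} {x} → x ∈ p → x ∈ p ∪ q
∈∪ˡ m = x∈p∪q⁺ (inj₁ m)

∈∪ʳ : ∀ {n} {p q : Subset n} {x} → x ∈ q → x ∈ p ∪ q
∈∪ʳ m = x∈p∪q⁺ (inj₂ m)

∈∪⁻ : ∀ {n} {p q : Subset n} {x} → x ∈ p ∪ q → x ∈ p ⊎ x ∈ q
∈∪⁻ {p = p} {q} m = x∈p∪q⁻ p q m

∈∩ : ∀ {n} {p q : Subset n} {x} → x ∈ p → x ∈ q → x ∈ p ∩ q
∈∩ a b = x∈p∩q⁺ (a , b)

∈∩⁻ˡ : ∀ {n} {p q : Subset n} {x} → x ∈ p ∩ q → x ∈ p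
∈∩⁻ˡ {p = p} {q} m = proj₁ (x∈p∩q⁻ p q m)

∈∩⁻ʳ : ∀ {n} {p q : Subset n} {x} → x ∈ p ∩ q → x ∈ q
∈∩⁻ʳ {p = p} {q} m = proj₂ (x∈p∩q⁻ p q m)

∈⁅⁆ : ∀ {n} {x y : Fin n} → x ∈ ⁅ y ⁆ → x ≡ y
∈⁅⁆ {y = y} = x∈⁅y⁆⇒x≡y y

≢⇒∈∁⁅⁆ : ∀ {n} {u v : Fin n} → u ≢ v → u ∈ ∁ ⁅ v ⁆
≢⇒∈∁⁅⁆ ne = x∉p⇒x∈∁p (λ m → ne (∈⁅⁆ m))

∉∁⁅⁆ : ∀ {n} (v : Fin n) → v ∉ ∁ ⁅ v ⁆
∉∁⁅⁆ v m = x∈∁p⇒x∉p m (x∈⁅x⁆ v)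

∉-self : ∀ {n} {p : Subset n} {x} → x ∉ p - x
∉-self {p = _ ∷ p} {zero} ()
∉-self {p = _ ∷ p} {suc x} (there m) = ∉-self {p = p} {x} m

∈- : ∀ {n} {p : Subset n} {x y} → x ∈ p - y → x ∈ p × x ≢ y
∈- {p = p} {x} {y} m = p─q⊆p p ⁅ y ⁆ m , λ { refl → ∉-self {p = p} m }

∈pair : ∀ {k} {a b w : Fin k} → w ∈ ⁅ a ⁆ ∪ ⁅ b ⁆ → w ≡ a ⊎ w ≡ b
∈pair {a = a} m with ∈∪⁻ {p = ⁅ a ⁆} m
... | inj₁ x = inj₁ (∈⁅⁆ x)
... | inj₂ x = inj₂ (∈⁅⁆ x)

pairˡ : ∀ {k} {a b : Fin k} → a ∈ ⁅ a ⁆ ∪ ⁅ b ⁆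
pairˡ {a = a} = ∈∪ˡ (x∈⁅x⁆ a)

pairʳ : ∀ {k} {a b : Fin k} → b ∈ ⁅ a ⁆ ∪ ⁅ b ⁆
pairʳ {a = a} {b} = ∈∪ʳ {p = ⁅ a ⁆} (x∈⁅x⁆ b)

subset-ext : ∀ {n} {p q : Subset n} → (∀ x → x ∈ p → x ∈ q) → (∀ x → x ∈ q → x ∈ p) → p ≡ q
subset-ext a b = ⊆-antisym (λ {x} → a x) (λ {x} → b x)

case-dec : ∀ {a b} {A : Set a} {B : Set b} → Dec A → (A → B) → (¬ A → B) → B
case-dec d f g = [ f , g ]′ (toSum d)

card-∪∩ : ∀ {n} (p q : Subset n) → ∣ p ∪ q ∣ + ∣ p ∩ q ∣ ≡ ∣ p ∣ + ∣ q ∣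
card-∪∩ [] [] = refl
card-∪∩ (true ∷ p) (true ∷ q) = cong suc (trans (+-suc _ _) (trans (cong suc (card-∪∩ p q)) (sym (+-suc _ _))))
card-∪∩ (true ∷ p) (false ∷ q) = cong suc (card-∪∩ p q)
card-∪∩ (false ∷ p) (true ∷ q) = trans (cong suc (card-∪∩ p q)) (sym (+-suc _ _))
card-∪∩ (false ∷ p) (false ∷ q) = card-∪∩ p q

card-∪ : ∀ {n} (p q : Subset n) → ∣ p ∪ q ∣ ≤ ∣ p ∣ + ∣ q ∣
card-∪ p q = ≤-trans (m≤m+n _ _) (≤-reflexive (card-∪∩ p q))

card-disjoint-∪ : ∀ {n} (p q : Subset n) → Empty (p ∩ q) → ∣ p ∪ q ∣ ≡ ∣ p ∣ + ∣ q ∣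
card-disjoint-∪ {n} p q em = begin
  ∣ p ∪ q ∣               ≡⟨ sym (+-identityʳ _) ⟩
  ∣ p ∪ q ∣ + 0           ≡⟨ cong (∣ p ∪ q ∣ +_) (sym (trans (cong ∣_∣ (Empty-unique em)) (∣⊥∣≡0 n))) ⟩
  ∣ p ∪ q ∣ + ∣ p ∩ q ∣   ≡⟨ card-∪∩ p q ⟩
  ∣ p ∣ + ∣ q ∣           ∎
  where open ≡-Reasoning

card-split : ∀ {n} (p q : Subset n) → ∣ p ∩ q ∣ + ∣ p ∩ ∁ q ∣ ≡ ∣ p ∣
card-split [] [] = refl
card-split (true ∷ p) (true ∷ q) = cong suc (card-split p q)
card-split (true ∷ p) (false ∷ q) = trans (+-suc _ _) (cong suc (card-split p q))
card-split (false ∷ p) (true ∷ q) = card-split p q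
card-split (false ∷ p) (false ∷ q) = card-split p q

card-minus : ∀ {n} (p : Subset n) u → ∣ p ∣ ≤ ∣ p - u ∣ + 1
card-minus p u = begin
  ∣ p ∣                   ≤⟨ p⊆q⇒∣p∣≤∣q∣ cover ⟩
  ∣ (p - u) ∪ ⁅ u ⁆ ∣     ≤⟨ card-∪ (p - u) ⁅ u ⁆ ⟩
  ∣ p - u ∣ + ∣ ⁅ u ⁆ ∣   ≡⟨ cong (∣ p - u ∣ +_) (∣⁅x⁆∣≡1 u) ⟩
  ∣ p - u ∣ + 1           ∎
  where
  open ≤-Reasoning
  cover : p ⊆ (p - u) ∪ ⁅ u ⁆
  cover {x} xp with x ≟ u
  ... | yes refl = ∈∪ʳ (x∈⁅x⁆ x)
  ... | no ne = ∈∪ˡ (x∈p∧x≢y⇒x∈p-y xp ne)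

⊆⁅⁆-card : ∀ {n} {p : Subset n} {v} → p ⊆ ⁅ v ⁆ → ∣ p ∣ ≤ 1
⊆⁅⁆-card {v = v} s = ≤-trans (p⊆q⇒∣p∣≤∣q∣ s) (≤-reflexive (∣⁅x⁆∣≡1 v))

∣pair∣≤2 : ∀ {n} (a b : Fin n) → ∣ ⁅ a ⁆ ∪ ⁅ b ⁆ ∣ ≤ 2
∣pair∣≤2 a b = ≤-trans (card-∪ ⁅ a ⁆ ⁅ b ⁆) (≤-reflexive (cong₂ _+_ (∣⁅x⁆∣≡1 a) (∣⁅x⁆∣≡1 b)))

card≥2 : ∀ {n} {p : Subset n} {x y} → x ∈ p → y ∈ p → x ≢ y → 2 ≤ ∣ p ∣
card≥2 {p = p} {x} {y} xp yp ne =
  ≤-trans (s≤s (≤-trans (s≤s z≤n) (x∈p⇒∣p-x∣<∣p∣ {p = p - x} (x∈p∧x≢y⇒x∈p-y yp (λ e → ne (sym e))))))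
    (x∈p⇒∣p-x∣<∣p∣ {p = p} xp)

⊆-card-≡ : ∀ {n} {p q : Subset n} → p ⊆ q → ∣ q ∣ ≤ ∣ p ∣ → p ≡ q
⊆-card-≡ {p = p} {q} s le = ⊆-antisym s back
  where
  back : q ⊆ p
  back {y} yq = decidable-stable (y ∈? p) (λ ny → <⇒≱ (p⊂q⇒∣p∣<∣q∣ (s , y , yq , ny)) le)

∃-outside : ∀ {n} (S Q : Subset n) → ∣ S ∣ < ∣ Q ∣ → ∃ λ y → y ∈ Q × y ∉ S
∃-outside {n} S Q lt with FinP.any? (λ y → (y ∈? Q) ×-dec (¬? (y ∈? S)))
... | yes (y , a , b) = y , a , b
... | no none = ⊥-elim (<⇒≱ lt (p⊆q⇒∣p∣≤∣q∣ Q⊆S))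
  where
  Q⊆S : Q ⊆ S
  Q⊆S {y} yQ = decidable-stable (y ∈? S) (λ yS → none (y , yQ , yS))

∃-member : ∀ {n} (Q : Subset n) → 1 ≤ ∣ Q ∣ → ∃ λ y → y ∈ Q
∃-member {n} Q le with ∃-outside ⊥ Q (≤-trans (≤-reflexive (cong suc (∣⊥∣≡0 n))) le)
... | y , a , _ = y , a

∃-other : ∀ {n} (p : Subset n) u → 2 ≤ ∣ p ∣ → ∃ λ w → w ∈ p × w ≢ u
∃-other p u le with ∃-member (p - u) (+-cancelʳ-≤ 1 1 ∣ p - u ∣ (≤-trans le (card-minus p u)))
... | w , m = w , ∈- m

∃-third : ∀ {n} (p : Subset n) u v → 3 ≤ ∣ p ∣ → ∃ λ w → w ∈ p × w ≢ u × w ≢ v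
∃-third p u v le with ∃-other (p - u) v (+-cancelʳ-≤ 1 2 ∣ p - u ∣ (≤-trans le (card-minus p u)))
... | w , m , nv = w , proj₁ (∈- m) , proj₂ (∈- m) , nv

card-≤-injection : ∀ {a b} (A : Subset a) (B : Subset b) (R : Fin a → Fin b → Set) →
  (∀ x → x ∈ A → ∃ λ y → y ∈ B × R x y) →
  (∀ x x' y → x ∈ A → x' ∈ A → R x y → R x' y → x ≡ x') → ∣ A ∣ ≤ ∣ B ∣
card-≤-injection [] B R f inj = z≤n
card-≤-injection (false ∷ A) B R f inj =
  card-≤-injection A B (λ x → R (suc x)) (λ x m → f (suc x) (there m))
    (λ x x' y m m' r r' → FinP.suc-injective (inj (suc x) (suc x') y (there m) (there m') r r'))
card-≤-injection (true ∷ A) B R f inj with f zero here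
... | y₀ , y₀∈B , r₀ =
  ≤-trans (s≤s (card-≤-injection A (B - y₀) (λ x → R (suc x)) image injective)) (x∈p⇒∣p-x∣<∣p∣ y₀∈B)
  where
  image : ∀ x → x ∈ A → ∃ λ y → y ∈ B - y₀ × R (suc x) y
  image x m with f (suc x) (there m)
  ... | y , yB , r = y , x∈p∧x≢y⇒x∈p-y yB (λ { refl → FinP.0≢1+n (sym (inj (suc x) zero y (there m) here r r₀)) }) , r
  injective : ∀ x x' y → x ∈ A → x' ∈ A → R (suc x) y → R (suc x') y → x ≡ x'
  injective x x' y m m' r r' = FinP.suc-injective (inj (suc x) (suc x') y (there m) (there m') r r')

idx : ∀ {n} (p : Subset n) x → x ∈ p → Fin ∣ p ∣
idx (true ∷ p) zero here = zero
idx (true ∷ p) (suc x) (there m) = suc (idx p x m)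
idx (false ∷ p) (suc x) (there m) = idx p x m

idx-cong : ∀ {n} (p : Subset n) {x y} (m : x ∈ p) (m' : y ∈ p) → x ≡ y → idx p x m ≡ idx p y m'
idx-cong (true ∷ p) here here refl = refl
idx-cong (true ∷ p) (there m) (there m') refl = cong suc (idx-cong p m m' refl)
idx-cong (false ∷ p) (there m) (there m') refl = idx-cong p m m' refl

idx-injective : ∀ {n} (p : Subset n) {x y} (m : x ∈ p) (m' : y ∈ p) → idx p x m ≡ idx p y m' → x ≡ y
idx-injective (true ∷ p) here here e = refl
idx-injective (true ∷ p) here (there m') ()
idx-injective (true ∷ p) (there m) here ()
idx-injective (true ∷ p) (there m) (there m') e = cong suc (idx-injective p m m' (FinP.suc-injective e))
idx-injective (false ∷ p) (there m) (there m') e = cong suc (idx-injective p m m' e)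

idx-surjective : ∀ {n} (p : Subset n) (j : Fin ∣ p ∣) → ∃ λ x → Σ (x ∈ p) λ m → idx p x m ≡ j
idx-surjective (true ∷ p) zero = zero , here , refl
idx-surjective (true ∷ p) (suc j) with idx-surjective p j
... | x , m , e = suc x , there m , cong suc e
idx-surjective (false ∷ p) j with idx-surjective p j
... | x , m , e = suc x , there m , e

-- Rc S is the set of all y with a Rel-walk from some x ∈ S to y; it is
-- computed by iterating one step n+1 times, which suffices because a
-- strictly growing chain of subsets of Fin n has length at most n.

module Closure {n : ℕ} (Rel : Fin n → Fin n → Set) (dec : ∀ x y → Dec (Rel x y)) where

  new : Subset n → Subset n
  new S = ⟦ (λ y → does (FinP.any? (λ x → (x ∈? S) ×-dec dec x y))) ⟧

  step : Subset n → Subset n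
  step S = S ∪ new S

  iterate : ℕ → Subset n → Subset n
  iterate zero S = S
  iterate (suc k) S = step (iterate k S)

  step-mono : ∀ {A B} → A ⊆ B → step A ⊆ step B
  step-mono {A} {B} s m with ∈∪⁻ {p = A} m
  ... | inj₁ a = ∈∪ˡ (s a)
  ... | inj₂ b with ∈⟦d⟧⁻ {d = λ y → FinP.any? (λ x → (x ∈? A) ×-dec dec x y)} b
  ...   | x , xA , r = ∈∪ʳ (∈⟦d⟧⁺ {d = λ y → FinP.any? (λ x → (x ∈? B) ×-dec dec x y)} (x , s xA , r))

  step-in : ∀ {A x y} → x ∈ A → Rel x y → y ∈ step A
  step-in {A} xA r = ∈∪ʳ (∈⟦d⟧⁺ {d = λ y → FinP.any? (λ x → (x ∈? A) ×-dec dec x y)} (_ , xA , r))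

  stable-or-large : ∀ k S → (step (iterate k S) ⊆ iterate k S) ⊎ (k ≤ ∣ iterate k S ∣)
  stable-or-large zero S = inj₂ z≤n
  stable-or-large (suc k) S with stable-or-large k S
  ... | inj₁ st = inj₁ (step-mono st)
  ... | inj₂ le with step (iterate k S) ⊆? iterate k S
  ...   | yes st = inj₁ (step-mono st)
  ...   | no nst = inj₂ (≤-trans (s≤s le) (p⊂q⇒∣p∣<∣q∣ (∈∪ˡ , y , y∈step , y∉R)))
    where
    R = iterate k S
    witness = FinP.¬∀⟶∃¬ n (λ y → y ∈ step R → y ∈ R) (λ y → (y ∈? step R) →-dec (y ∈? R)) (λ f → nst (λ {x} → f x))
    y = proj₁ witness
    y∈step : y ∈ step R
    y∈step = decidable-stable (y ∈? step R) (λ ny → proj₂ witness (λ a → ⊥-elim (ny a)))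
    y∉R : y ∉ R
    y∉R a = proj₂ witness (λ _ → a)

  Rc : Subset n → Subset n
  Rc S = iterate (suc n) S

  Rc-closed : ∀ S {x y} → x ∈ Rc S → Rel x y → y ∈ Rc S
  Rc-closed S xm r = stable (step-in xm r)
    where
    stable : step (Rc S) ⊆ Rc S
    stable with stable-or-large (suc n) S
    ... | inj₁ st = st
    ... | inj₂ le = ⊥-elim (<⇒≱ (s≤s (∣p∣≤n (Rc S))) le)

  iterate-⊇ : ∀ k S → S ⊆ iterate k S
  iterate-⊇ zero S m = m
  iterate-⊇ (suc k) S m = ∈∪ˡ (iterate-⊇ k S m)

  complete : ∀ S {x y} → x ∈ S → Star Rel x y → y ∈ Rc S
  complete S m rs = go (iterate-⊇ (suc n) S m) rs
    where
    go : ∀ {x y} → x ∈ Rc S → Star Rel x y → y ∈ Rc S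
    go m ε = m
    go m (r ◅ rs) = go (Rc-closed S m r) rs

  sound : ∀ k S {y} → y ∈ iterate k S → ∃ λ x → x ∈ S × Star Rel x y
  sound zero S m = _ , m , ε
  sound (suc k) S m with ∈∪⁻ {p = iterate k S} m
  ... | inj₁ a = sound k S a
  ... | inj₂ b with ∈⟦d⟧⁻ {d = λ y → FinP.any? (λ x → (x ∈? iterate k S) ×-dec dec x y)} b
  ...   | x' , x'm , r with sound k S x'm
  ...     | x , xS , rs = x , xS , (rs ◅◅ (r ◅ ε))

  Rc-single⁻ : ∀ {x y} → y ∈ Rc ⁅ x ⁆ → Star Rel x y
  Rc-single⁻ {x} {y} m with sound (suc n) ⁅ x ⁆ m
  ... | x' , x'm , rs = subst (λ z → Star Rel z y) (∈⁅⁆ x'm) rs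

  Rc-single⁺ : ∀ {x y} → Star Rel x y → y ∈ Rc ⁅ x ⁆
  Rc-single⁺ {x} = complete ⁅ x ⁆ (x∈⁅x⁆ x)

module Colouring (C : Configuration) (df : DegreeFeasible C) where
  G₀ = G C
  c = cov C
  H₀ = H c
  nv = nV G₀
  nh = nV H₀
  π₀ = π c
  φ₀ = φ c

  X⁻ : ∀ {y w} → y ∈ X c w → π₀ y ≡ w
  X⁻ {y} {w} m = ∈⟦d⟧⁻ {d = λ x → π₀ x ≟ w} m

  X⁺ : ∀ {y w} → π₀ y ≡ w → y ∈ X c w
  X⁺ {y} {w} e = ∈⟦d⟧⁺ {d = λ x → π₀ x ≟ w} e

  meet-unique : ∀ f w a a' → w ∈ inc G₀ (φ₀ f) → a ∈ inc H₀ f → a' ∈ inc H₀ f → π₀ a ≡ w → π₀ a' ≡ w → a ≡ a'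
  meet-unique f w a a' wm am am' pa pa' = decidable-stable (a ≟ a') λ ne →
    <⇒≱ (card≥2 (∈∩ am (X⁺ pa)) (∈∩ am' (X⁺ pa')) ne) (≤-reflexive (φ-meets c f w wm))

  meet-exists : ∀ f w → w ∈ inc G₀ (φ₀ f) → ∃ λ a → a ∈ inc H₀ f × π₀ a ≡ w
  meet-exists f w wm with ∃-member (inc H₀ f ∩ X c w) (≤-reflexive (sym (φ-meets c f w wm)))
  ... | a , m = a , ∈∩⁻ˡ m , X⁻ (∈∩⁻ʳ {p = inc H₀ f} m)

  matching-unique : ∀ f f' a → φ₀ f ≡ φ₀ f' → a ∈ inc H₀ f → a ∈ inc H₀ f' → f ≡ f'
  matching-unique f f' a eq m m' = decidable-stable (f ≟ f') λ ne → φ-matching c f f' ne eq (a , ∈∩ m m')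

  no-edge-in-singleton : ∀ f a → ¬ (inc H₀ f ⊆ ⁅ a ⁆)
  no-edge-in-singleton f a s with ∃-other (inc H₀ f) a (inc-≥2 H₀ f)
  ... | b , bm , ne = ne (∈⁅⁆ (s bm))

  -- inclusion with explicit elements, convenient to build by λ
  infix 4 _⊆'_
  _⊆'_ : ∀ {k} → Subset k → Subset k → Set
  A ⊆' B = ∀ a → a ∈ A → a ∈ B

  ⊆'-trans : ∀ {k} {A B D : Subset k} → A ⊆' B → B ⊆' D → A ⊆' D
  ⊆'-trans a b x m = b x (a x m)

  record Partial (P : Subset nv) (T : Subset nh) : Set where
    field
      independent : Independent H₀ T
      coloured-in : ∀ y → y ∈ T → π₀ y ∈ P
      coloured : ∀ w → w ∈ P → ∃ λ y → y ∈ T × π₀ y ≡ w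
      one-per-class : ∀ y y' → y ∈ T → y' ∈ T → π₀ y ≡ π₀ y' → y ≡ y'
  open Partial public

  Partial-resp : ∀ {P P' T} → P ⊆' P' → P' ⊆' P → Partial P T → Partial P' T
  Partial-resp a b s = record
    { independent = independent s
    ; coloured-in = λ y m → a _ (coloured-in s y m)
    ; coloured = λ w m → coloured s w (b w m)
    ; one-per-class = one-per-class s }

  Partial-empty : Partial ⊥ ⊥
  Partial-empty = record
    { independent = λ f s → ∉⊥ (s (proj₂ (∃-member (inc H₀ f) (≤-trans (s≤s z≤n) (inc-≥2 H₀ f)))))
    ; coloured-in = λ y m → ⊥-elim (∉⊥ m)
    ; coloured = λ w m → ⊥-elim (∉⊥ m)
    ; one-per-class = λ y y' m → ⊥-elim (∉⊥ m) }

  hits-once : ∀ {P T u} → Partial P T → u ∈ P → ∣ T ∩ X c u ∣ ≡ 1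
  hits-once {P} {T} {u} s uP with coloured s u uP
  ... | y , yT , py = ≤-antisym (⊆⁅⁆-card only-y) (≤-trans (≤-reflexive (sym (∣⁅x⁆∣≡1 y))) (p⊆q⇒∣p∣≤∣q∣ y-in))
    where
    only-y : T ∩ X c u ⊆ ⁅ y ⁆
    only-y {x} m = subst (_∈ ⁅ y ⁆) (sym (one-per-class s x y (∈∩⁻ˡ m) yT (trans (X⁻ (∈∩⁻ʳ {p = T} m)) (sym py)))) (x∈⁅x⁆ y)
    y-in : ⁅ y ⁆ ⊆ T ∩ X c u
    y-in {x} m = subst (_∈ T ∩ X c u) (sym (∈⁅⁆ m)) (∈∩ yT (X⁺ py))

  complete-colouring : ∀ {T} → Partial ⊤ T → ∃ λ T → Independent H₀ T × (∀ v → ∣ T ∩ X c v ∣ ≡ 1)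
  complete-colouring {T} s = T , independent s , (λ v → hits-once s ∈⊤)

  Addable : Subset nh → Fin nh → Set
  Addable T y = ∀ f → ¬ (inc H₀ f ⊆' (T ∪ ⁅ y ⁆))

  addable-to-empty : ∀ x → Addable ⊥ x
  addable-to-empty x f sb = no-edge-in-singleton f x (λ {a} m → [ (λ z → ⊥-elim (∉⊥ z)) , (λ z → z) ]′ (∈∪⁻ {p = ⊥} (sb a m)))

  extend : ∀ {P T u y} → Partial P T → u ∉ P → π₀ y ≡ u → Addable T y → Partial (P ∪ ⁅ u ⁆) (T ∪ ⁅ y ⁆)
  extend {P} {T} {u} {y} s uP py g = record
    { independent = λ f sb → g f (λ a m → sb m) ; coloured-in = over-P∪u ; coloured = hits ; one-per-class = unique }
    where
    over-P∪u : ∀ a → a ∈ T ∪ ⁅ y ⁆ → π₀ a ∈ P ∪ ⁅ u ⁆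
    over-P∪u a m with ∈∪⁻ {p = T} m
    ... | inj₁ aT = ∈∪ˡ (coloured-in s a aT)
    ... | inj₂ ay rewrite ∈⁅⁆ ay = ∈∪ʳ (subst (_∈ ⁅ u ⁆) (sym py) (x∈⁅x⁆ u))
    hits : ∀ w → w ∈ P ∪ ⁅ u ⁆ → ∃ λ a → a ∈ T ∪ ⁅ y ⁆ × π₀ a ≡ w
    hits w m with ∈∪⁻ {p = P} m
    ... | inj₁ wP = let (a , aT , pa) = coloured s w wP in a , ∈∪ˡ aT , pa
    ... | inj₂ wu = y , ∈∪ʳ (x∈⁅x⁆ y) , trans py (sym (∈⁅⁆ wu))
    not-over-u : ∀ {a} → a ∈ T → π₀ a ≢ u
    not-over-u aT eq = uP (subst (_∈ P) eq (coloured-in s _ aT))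
    unique : ∀ a a' → a ∈ T ∪ ⁅ y ⁆ → a' ∈ T ∪ ⁅ y ⁆ → π₀ a ≡ π₀ a' → a ≡ a'
    unique a a' m m' eq with ∈∪⁻ {p = T} m | ∈∪⁻ {p = T} m'
    ... | inj₁ aT | inj₁ aT' = one-per-class s a a' aT aT' eq
    ... | inj₁ aT | inj₂ ay' = ⊥-elim (not-over-u aT (trans eq (trans (cong π₀ (∈⁅⁆ ay')) py)))
    ... | inj₂ ay | inj₁ aT' = ⊥-elim (not-over-u aT' (trans (sym eq) (trans (cong π₀ (∈⁅⁆ ay)) py)))
    ... | inj₂ ay | inj₂ ay' = trans (∈⁅⁆ ay) (sym (∈⁅⁆ ay'))

  module BlockingEdge {P T u y f} (s : Partial P T) (uP : u ∉ P) (py : π₀ y ≡ u) (sb : inc H₀ f ⊆' (T ∪ ⁅ y ⁆)) where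
    y∈f : y ∈ inc H₀ f
    y∈f = decidable-stable (y ∈? inc H₀ f) λ y∉f → independent s f (λ {a} am → in-T a am y∉f)
      where
      in-T : ∀ a → a ∈ inc H₀ f → y ∉ inc H₀ f → a ∈ T
      in-T a am y∉f with ∈∪⁻ {p = T} (sb _ am)
      ... | inj₁ aT = aT
      ... | inj₂ ay = ⊥-elim (y∉f (subst (_∈ inc H₀ f) (∈⁅⁆ ay) am))

    u∈e : u ∈ inc G₀ (φ₀ f)
    u∈e = subst (_∈ inc G₀ (φ₀ f)) py (φ-inside c f y y∈f)

    inT : ∀ a → a ∈ inc H₀ f → π₀ a ≢ u → a ∈ T
    inT a am ne with ∈∪⁻ {p = T} (sb _ am)
    ... | inj₁ aT = aT
    ... | inj₂ ay = ⊥-elim (ne (trans (cong π₀ (∈⁅⁆ ay)) py))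

    over : ∀ w → w ∈ inc G₀ (φ₀ f) → w ≢ u → ∃ λ a → a ∈ inc H₀ f × a ∈ T × π₀ a ≡ w
    over w wm ne with meet-exists f w wm
    ... | a , am , pa = a , am , inT a am (λ e → ne (trans (sym pa) e)) , pa

    others : ∀ w → w ∈ inc G₀ (φ₀ f) → w ≢ u → w ∈ P
    others w wm ne with over w wm ne
    ... | a , _ , aT , pa = subst (_∈ P) pa (coloured-in s a aT)

  -- distinct blocked vertices of X_u are blocked by different matchings:
  -- the blocking edges agree over a second vertex w of e, hence coincide
  blocking-injective : ∀ {P T u y y' f f'} → Partial P T → u ∉ P → π₀ y ≡ u → π₀ y' ≡ u →
    inc H₀ f ⊆' (T ∪ ⁅ y ⁆) → inc H₀ f' ⊆' (T ∪ ⁅ y' ⁆) → φ₀ f ≡ φ₀ f' → y ≡ y'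
  blocking-injective {P} {T} {u} {y} {y'} {f} {f'} s uP py py' sb sb' eq =
    meet-unique f u y y' A.u∈e A.y∈f (subst (λ g → y' ∈ inc H₀ g) (sym f≡f') B.y∈f) py py'
    where
    module A = BlockingEdge s uP py sb
    module B = BlockingEdge s uP py' sb'
    f≡f' : f ≡ f'
    f≡f' with ∃-other (inc G₀ (φ₀ f)) u (inc-≥2 G₀ (φ₀ f))
    ... | w , wm , w≢u with A.over w wm w≢u | B.over w (subst (λ e → w ∈ inc G₀ e) eq wm) w≢u
    ...   | a , af , aT , pa | a' , af' , aT' , pa' =
      matching-unique f f' a eq af (subst (_∈ inc H₀ f') (sym (one-per-class s a a' aT aT' (trans pa (sym pa')))) af')

  blocked? : ∀ T y → Dec (∃ λ f → inc H₀ f ⊆ (T ∪ ⁅ y ⁆))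
  blocked? T y = FinP.any? (λ f → inc H₀ f ⊆? (T ∪ ⁅ y ⁆))

  Blocked : Subset nh → Fin nv → Subset nh
  Blocked T u = X c u ∩ ⟦ (λ y → does (blocked? T y)) ⟧

  addable-if-unblocked : ∀ {T u y} → y ∈ X c u → y ∉ Blocked T u → Addable T y
  addable-if-unblocked {T} {u} {y} ym nb f sb = nb (∈∩ ym (∈⟦d⟧⁺ {d = blocked? T} (f , (λ {x} → sb x))))

  blocked-count : ∀ {P T u} → Partial P T → u ∉ P → (Q : Subset nh) → (E' : Subset (nE G₀)) →
    (∀ y f → y ∈ Q → π₀ y ≡ u → inc H₀ f ⊆' (T ∪ ⁅ y ⁆) → φ₀ f ∈ E') → ∣ Blocked T u ∩ Q ∣ ≤ ∣ E' ∣
  blocked-count {P} {T} {u} s uP Q E' hyp =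
    card-≤-injection (Blocked T u ∩ Q) E' (λ y e → ∃ λ f → φ₀ f ≡ e × inc H₀ f ⊆' (T ∪ ⁅ y ⁆)) image injective
    where
    image : ∀ y → y ∈ Blocked T u ∩ Q → ∃ λ e → e ∈ E' × ∃ λ f → φ₀ f ≡ e × inc H₀ f ⊆' (T ∪ ⁅ y ⁆)
    image y m with ∈⟦d⟧⁻ {d = blocked? T} (∈∩⁻ʳ {p = X c u} (∈∩⁻ˡ m))
    ... | f , sb = φ₀ f , hyp y f (∈∩⁻ʳ {p = Blocked T u} m) (X⁻ (∈∩⁻ˡ (∈∩⁻ˡ m))) (λ _ → sb) , f , refl , (λ _ → sb)
    injective : ∀ y y' e → y ∈ Blocked T u ∩ Q → y' ∈ Blocked T u ∩ Q →
      (∃ λ f → φ₀ f ≡ e × inc H₀ f ⊆' (T ∪ ⁅ y ⁆)) → (∃ λ f → φ₀ f ≡ e × inc H₀ f ⊆' (T ∪ ⁅ y' ⁆)) → y ≡ y'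
    injective y y' e m m' (f , fe , sb) (f' , fe' , sb') =
      blocking-injective s uP (X⁻ (∈∩⁻ˡ (∈∩⁻ˡ m))) (X⁻ (∈∩⁻ˡ (∈∩⁻ˡ m'))) sb sb' (trans fe (sym fe'))

  blocked-count-all : ∀ {P T u} → Partial P T → u ∉ P → (E' : Subset (nE G₀)) →
    (∀ y f → π₀ y ≡ u → inc H₀ f ⊆' (T ∪ ⁅ y ⁆) → φ₀ f ∈ E') → ∣ Blocked T u ∣ ≤ ∣ E' ∣
  blocked-count-all {T = T} {u} s uP E' hyp =
    subst (_≤ ∣ E' ∣) (cong ∣_∣ (∩-identityʳ (Blocked T u))) (blocked-count s uP ⊤ E' (λ y f _ → hyp y f))

  choose-addable : ∀ {P T u} → Partial P T → u ∉ P → (E' : Subset (nE G₀)) →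
    (∀ y f → π₀ y ≡ u → inc H₀ f ⊆' (T ∪ ⁅ y ⁆) → φ₀ f ∈ E') → ∣ E' ∣ < ∣ X c u ∣ →
    ∃ λ y → π₀ y ≡ u × Addable T y
  choose-addable {P} {T} {u} s uP E' hyp lt with ∃-outside (Blocked T u) (X c u) (≤-trans (s≤s (blocked-count-all s uP E' hyp)) lt)
  ... | y , ym , nb = y , X⁻ ym , addable-if-unblocked ym nb

  Full : Subset nv → Fin nv → Subset (nE G₀)
  Full P u = edgesAt G₀ u ∩ ⟦ (λ e → does (inc G₀ e ⊆? (P ∪ ⁅ u ⁆))) ⟧

  blocking-edge-full : ∀ {P T u} → Partial P T → u ∉ P → ∀ y f → π₀ y ≡ u → inc H₀ f ⊆' (T ∪ ⁅ y ⁆) → φ₀ f ∈ Full P u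
  blocking-edge-full {P} {T} {u} s uP y f py sb =
    ∈∩ (∈⟦d⟧⁺ {d = λ e → u ∈? inc G₀ e} A.u∈e)
       (∈⟦d⟧⁺ {d = λ e → inc G₀ e ⊆? (P ∪ ⁅ u ⁆)} (λ {w} wm → in-P∪u w wm))
    where
    module A = BlockingEdge s uP py sb
    in-P∪u : ∀ w → w ∈ inc G₀ (φ₀ f) → w ∈ P ∪ ⁅ u ⁆
    in-P∪u w wm with w ≟ u
    ... | yes refl = ∈∪ʳ (x∈⁅x⁆ w)
    ... | no ne = ∈∪ˡ (A.others w wm ne)

  full-<-deg : ∀ {P u e b} → u ∈ inc G₀ e → b ∈ inc G₀ e → b ∉ P → b ≢ u → ∣ Full P u ∣ < deg G₀ u
  full-<-deg {P} {u} {e} {b} ue be bP bu = p⊂q⇒∣p∣<∣q∣ (∈∩⁻ˡ , e , ∈⟦d⟧⁺ {d = λ e → u ∈? inc G₀ e} ue , e∉Full)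
    where
    e∉Full : e ∉ Full P u
    e∉Full m with ∈∪⁻ {p = P} (∈⟦d⟧⁻ {d = λ e → inc G₀ e ⊆? (P ∪ ⁅ u ⁆)} (∈∩⁻ʳ {p = edgesAt G₀ u} m) be)
    ... | inj₁ x = bP x
    ... | inj₂ x = bu (∈⁅⁆ x)

  colour-vertex : ∀ {P T u e b} → Partial P T → u ∉ P → u ∈ inc G₀ e → b ∈ inc G₀ e → b ∉ P → b ≢ u →
    ∃ λ y → π₀ y ≡ u × Partial (P ∪ ⁅ u ⁆) (T ∪ ⁅ y ⁆)
  colour-vertex {P} {T} {u} s uP ue be bP bu
    with choose-addable s uP (Full P u) (blocking-edge-full s uP) (≤-trans (full-<-deg ue be bP bu) (df u))
  ... | y , py , g = y , py , extend s uP py g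

  -- Colouring a set W of uncoloured vertices, each of which lies in an edge
  -- with an uncoloured vertex outside W: colour them one at a time (k
  -- bounds |W|); every vertex keeps its uncoloured neighbour outside W.
  colour-set : ∀ k {P T} (W : Subset nv) → Partial P T → ∣ W ∣ ≤ k → (∀ w → w ∈ W → w ∉ P) →
    (∀ w → w ∈ W → ∃ λ e → w ∈ inc G₀ e × ∃ λ b → b ∈ inc G₀ e × b ∉ P × b ∉ W) →
    ∃ λ T' → Partial (P ∪ W) T' × T ⊆' T'
  colour-set k {P} {T} W s le disj hyp with nonempty? W
  ... | no empty = T , Partial-resp (λ w m → ∈∪ˡ m) (λ w m → [ (λ x → x) , (λ x → ⊥-elim (empty (w , x))) ]′ (∈∪⁻ {p = P} m)) s , (λ a m → m)
  ... | yes (w , wm) with k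
  ...   | zero = ⊥-elim (<⇒≱ (x∈p⇒∣p-x∣<∣p∣ wm) (≤-trans le z≤n))
  ...   | suc k' with hyp w wm
  ...     | e , we , b , be , bP , bW with colour-vertex s (disj w wm) we be bP (λ eq → bW (subst (_∈ W) (sym eq) wm))
  ...       | y , py , s' with colour-set k' (W - w) s' (≤-pred (≤-trans (x∈p⇒∣p-x∣<∣p∣ wm) le)) disj' hyp'
    where
    disj' : ∀ w' → w' ∈ W - w → w' ∉ P ∪ ⁅ w ⁆
    disj' w' m m' with ∈∪⁻ {p = P} m'
    ... | inj₁ x = disj w' (proj₁ (∈- m)) x
    ... | inj₂ x = proj₂ (∈- m) (∈⁅⁆ x)
    hyp' : ∀ w' → w' ∈ W - w → ∃ λ e → w' ∈ inc G₀ e × ∃ λ b → b ∈ inc G₀ e × b ∉ P ∪ ⁅ w ⁆ × b ∉ W - w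
    hyp' w' m with hyp w' (proj₁ (∈- m))
    ... | e' , we' , b' , be' , bP' , bW' = e' , we' , b' , be' ,
          (λ x → [ bP' , (λ z → bW' (subst (_∈ W) (sym (∈⁅⁆ z)) wm)) ]′ (∈∪⁻ {p = P} x)) , (λ z → bW' (proj₁ (∈- z)))
  ...         | T' , s'' , T⊆T' = T' , Partial-resp to from s'' , (λ a m → T⊆T' a (∈∪ˡ m))
    where
    to : (P ∪ ⁅ w ⁆) ∪ (W - w) ⊆' P ∪ W
    to v m with ∈∪⁻ {p = P ∪ ⁅ w ⁆} m
    ... | inj₂ x = ∈∪ʳ (proj₁ (∈- x))
    ... | inj₁ x with ∈∪⁻ {p = P} x
    ...   | inj₁ z = ∈∪ˡ z
    ...   | inj₂ z = ∈∪ʳ (subst (_∈ W) (sym (∈⁅⁆ z)) wm)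
    from : P ∪ W ⊆' (P ∪ ⁅ w ⁆) ∪ (W - w)
    from v m with ∈∪⁻ {p = P} m
    ... | inj₁ z = ∈∪ˡ (∈∪ˡ z)
    ... | inj₂ z with v ≟ w
    ...   | yes refl = ∈∪ˡ (∈∪ʳ (x∈⁅x⁆ v))
    ...   | no ne = ∈∪ʳ (x∈p∧x≢y⇒x∈p-y z ne)

  Step : Subset nv → Fin nv → Fin nv → Set
  Step P₀ a b = a ∉ P₀ × ∃ λ e → a ∈ inc G₀ e × b ∈ inc G₀ e

  -- Layered colouring: the k-th layer L k consists of the vertices reached
  -- from the roots R₀ in ≤ k steps through uncoloured vertices.  Colouring
  -- the layers from the outside in, every vertex of L (k+1) ∖ L k has an
  -- uncoloured neighbour in L k when it is coloured.
  module Layered {P₀ T₀} (s₀ : Partial P₀ T₀) (R₀ : Subset nv) (R₀-unc : ∀ r → r ∈ R₀ → r ∉ P₀) where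
    Rel : Fin nv → Fin nv → Set
    Rel b w = w ∉ P₀ × ∃ λ e → b ∈ inc G₀ e × w ∈ inc G₀ e

    rel? : ∀ b w → Dec (Rel b w)
    rel? b w = ¬? (w ∈? P₀) ×-dec FinP.any? (λ e → (b ∈? inc G₀ e) ×-dec (w ∈? inc G₀ e))

    open Closure Rel rel?

    L : ℕ → Subset nv
    L k = iterate k R₀

    new-in-L : ∀ k {w} → w ∈ new (L k) → ∃ λ b → b ∈ L k × Rel b w
    new-in-L k = ∈⟦d⟧⁻ {d = λ y → FinP.any? (λ x → (x ∈? L k) ×-dec rel? x y)}

    L-uncoloured : ∀ k w → w ∈ L k → w ∉ P₀
    L-uncoloured zero w m = R₀-unc w m
    L-uncoloured (suc k) w m with ∈∪⁻ {p = L k} m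
    ... | inj₁ x = L-uncoloured k w x
    ... | inj₂ x = proj₁ (proj₂ (proj₂ (new-in-L k x)))

    colour-down : ∀ k {T} → Partial (∁ (L k)) T → ∃ λ T' → Partial (∁ R₀) T' × T ⊆' T'
    colour-down zero {T} s = T , s , (λ a m → m)
    colour-down (suc k) {T} s with colour-set ∣ Wk ∣ Wk s ≤-refl disj hyp
      where
      Wk = L (suc k) ∩ ∁ (L k)
      disj : ∀ w → w ∈ Wk → w ∉ ∁ (L (suc k))
      disj w m m' = x∈∁p⇒x∉p m' (∈∩⁻ˡ m)
      hyp : ∀ w → w ∈ Wk → ∃ λ e → w ∈ inc G₀ e × ∃ λ b → b ∈ inc G₀ e × b ∉ ∁ (L (suc k)) × b ∉ Wk
      hyp w m with ∈∪⁻ {p = L k} (∈∩⁻ˡ m)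
      ... | inj₁ x = ⊥-elim (x∈∁p⇒x∉p (∈∩⁻ʳ {p = L (suc k)} m) x)
      ... | inj₂ x with new-in-L k x
      ...   | b , bL , wP , e , be , we = e , we , b , be , (λ z → x∈∁p⇒x∉p z (∈∪ˡ bL)) , (λ z → x∈∁p⇒x∉p (∈∩⁻ʳ {p = L (suc k)} z) bL)
    ... | T' , s' , T⊆T' with colour-down k (Partial-resp to from s')
      where
      Wk = L (suc k) ∩ ∁ (L k)
      to : ∁ (L (suc k)) ∪ Wk ⊆' ∁ (L k)
      to v m with ∈∪⁻ {p = ∁ (L (suc k))} m
      ... | inj₁ x = x∉p⇒x∈∁p (λ z → x∈∁p⇒x∉p x (∈∪ˡ z))
      ... | inj₂ x = ∈∩⁻ʳ {p = L (suc k)} x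
      from : ∁ (L k) ⊆' ∁ (L (suc k)) ∪ Wk
      from v m with v ∈? L (suc k)
      ... | yes z = ∈∪ʳ (∈∩ z m)
      ... | no z = ∈∪ˡ (x∉p⇒x∈∁p z)
    ... | T'' , s'' , T'⊆T'' = T'' , s'' , ⊆'-trans T⊆T' T'⊆T''

    colour-outside-roots : (∀ u → u ∉ P₀ → ∃ λ r → r ∈ R₀ × Star Rel r u) → ∃ λ T' → Partial (∁ R₀) T' × T₀ ⊆' T'
    colour-outside-roots reach = colour-down (suc nv) (Partial-resp to from s₀)
      where
      to : P₀ ⊆' ∁ (L (suc nv))
      to v m = x∉p⇒x∈∁p (λ z → L-uncoloured (suc nv) v z m)
      from : ∁ (L (suc nv)) ⊆' P₀
      from v m = decidable-stable (v ∈? P₀) λ v∉P₀ →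
        let (r , rm , st) = reach v v∉P₀ in x∈∁p⇒x∉p m (complete R₀ rm st)

  colour-towards : ∀ {P₀ T₀} → Partial P₀ T₀ → (R₀ : Subset nv) → (∀ r → r ∈ R₀ → r ∉ P₀) →
    (∀ u → u ∉ P₀ → ∃ λ r → r ∈ R₀ × Star (Step P₀) u r) → ∃ λ T' → Partial (∁ R₀) T' × T₀ ⊆' T'
  colour-towards {P₀} s₀ R₀ R₀-unc walks = Layered.colour-outside-roots s₀ R₀ R₀-unc reach
    where
    reach : ∀ u → u ∉ P₀ → ∃ λ r → r ∈ R₀ × Star (Layered.Rel s₀ R₀ R₀-unc) r u
    reach u uP with walks u uP
    ... | r , rm , w = r , rm , Star.reverse (λ { (aP , e , ae , be) → aP , e , be , ae }) w

  walk-or-coloured : ∀ {P₀} u v → Star (Step P₀) u v ⊎ ∃ λ w → w ∈ P₀ × Star (Step P₀) u w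
  walk-or-coloured {P₀} u v = go (connected C u v ∈⊤ ∈⊤)
    where
    go : ∀ {a b} → Star (Adj G₀ (whole G₀)) a b → Star (Step P₀) a b ⊎ ∃ λ w → w ∈ P₀ × Star (Step P₀) a w
    go ε = inj₁ ε
    go {a} ((e , _ , ae , be) ◅ rest) with a ∈? P₀
    ... | yes aP = inj₂ (a , aP , ε)
    ... | no aP with go rest
    ...   | inj₁ w = inj₁ ((aP , e , ae , be) ◅ w)
    ...   | inj₂ (w , wP , st) = inj₂ (w , wP , (aP , e , ae , be) ◅ st)

  colour-all-but : ∀ v → ∃ λ T → Partial (∁ ⁅ v ⁆) T
  colour-all-but v with colour-towards Partial-empty ⁅ v ⁆ (λ r _ → ∉⊥) walks
    where
    walks : ∀ u → u ∉ ⊥ → ∃ λ r → r ∈ ⁅ v ⁆ × Star (Step ⊥) u r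
    walks u _ = v , x∈⁅x⁆ v , [ (λ w → w) , (λ { (w , wP , _) → ⊥-elim (∉⊥ wP) }) ]′ (walk-or-coloured u v)
  ... | T , s , _ = T , s

  part-e : ∀ v → ∃ λ T → Independent H₀ T × (∀ u → u ≢ v → ∣ T ∩ X c u ∣ ≡ 1)
  part-e v with colour-all-but v
  ... | T , s = T , independent s , (λ u ne → hits-once s (≢⇒∈∁⁅⁆ ne))

  finish-colouring : ∀ {T v y} → Partial (∁ ⁅ v ⁆) T → π₀ y ≡ v → Addable T y →
    ∃ λ T → Independent H₀ T × (∀ v → ∣ T ∩ X c v ∣ ≡ 1)
  finish-colouring {T} {v} {y} s py g = complete-colouring (Partial-resp (λ _ _ → ∈⊤) all (extend s (∉∁⁅⁆ v) py g))
    where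
    all : ⊤ ⊆' ∁ ⁅ v ⁆ ∪ ⁅ v ⁆
    all w _ with w ≟ v
    ... | yes refl = ∈∪ʳ (x∈⁅x⁆ w)
    ... | no ne = ∈∪ˡ (≢⇒∈∁⁅⁆ ne)

  -- part (a): otherwise the last vertex v could be coloured, as every
  -- blocking edge is one of the d(v) < |X_v| edges at v
  part-a : Uncolorable C → ∀ v → ∣ X c v ∣ ≡ deg G₀ v
  part-a unc v with deg G₀ v <? ∣ X c v ∣
  ... | no ≮ = ≤-antisym (≮⇒≥ ≮) (df v)
  ... | yes lt with colour-all-but v
  ...   | T , s with choose-addable s (∉∁⁅⁆ v) (edgesAt G₀ v) at-v lt
    where
    at-v : ∀ y f → π₀ y ≡ v → inc H₀ f ⊆' (T ∪ ⁅ y ⁆) → φ₀ f ∈ edgesAt G₀ v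
    at-v y f py sb = ∈⟦d⟧⁺ {d = λ e → v ∈? inc G₀ e} (BlockingEdge.u∈e s (∉∁⁅⁆ v) py sb)
  ...     | y , py , g = ⊥-elim (unc (finish-colouring s py g))

  Mult : Fin nv → Fin nv → Subset (nE G₀)
  Mult v z = ⟦ (λ e → does (inc G₀ e ≟ₛ (⁅ v ⁆ ∪ ⁅ z ⁆))) ⟧

  Mult⁺ : ∀ {g a b} → inc G₀ g ≡ ⁅ a ⁆ ∪ ⁅ b ⁆ → g ∈ Mult a b
  Mult⁺ {g} {a} {b} eq = ∈⟦d⟧⁺ {d = λ e → inc G₀ e ≟ₛ (⁅ a ⁆ ∪ ⁅ b ⁆)} eq

  Mult⁻ : ∀ {g a b} → g ∈ Mult a b → inc G₀ g ≡ ⁅ a ⁆ ∪ ⁅ b ⁆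
  Mult⁻ {g} {a} {b} m = ∈⟦d⟧⁻ {d = λ e → inc G₀ e ≟ₛ (⁅ a ⁆ ∪ ⁅ b ⁆)} m

  Mult⊆edgesAt : ∀ v z → Mult v z ⊆ edgesAt G₀ v
  Mult⊆edgesAt v z m = ∈⟦d⟧⁺ {d = λ e → v ∈? inc G₀ e} (subst (v ∈_) (sym (Mult⁻ m)) pairˡ)

  neighbour? : ∀ x y → Dec (∃ λ f → inc H₀ f ≡ (⁅ x ⁆ ∪ ⁅ y ⁆))
  neighbour? x y = FinP.any? (λ f → inc H₀ f ≟ₛ (⁅ x ⁆ ∪ ⁅ y ⁆))

  N⁻ : ∀ {x y} → y ∈ N H₀ x → ∃ λ f → inc H₀ f ≡ (⁅ x ⁆ ∪ ⁅ y ⁆)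
  N⁻ {x} m = ∈⟦d⟧⁻ {d = neighbour? x} m

  N⁺ : ∀ {x y} → (∃ λ f → inc H₀ f ≡ (⁅ x ⁆ ∪ ⁅ y ⁆)) → y ∈ N H₀ x
  N⁺ {x} p = ∈⟦d⟧⁺ {d = neighbour? x} p

  pair-image : ∀ {x y f v z} → inc H₀ f ≡ (⁅ x ⁆ ∪ ⁅ y ⁆) → π₀ x ≡ z → π₀ y ≡ v → inc G₀ (φ₀ f) ≡ (⁅ v ⁆ ∪ ⁅ z ⁆)
  pair-image {x} {y} {f} {v} {z} eq px py = subset-ext to from
    where
    to : ∀ w → w ∈ inc G₀ (φ₀ f) → w ∈ ⁅ v ⁆ ∪ ⁅ z ⁆
    to w wm with meet-exists f w wm
    ... | a , am , pa with ∈pair (subst (a ∈_) eq am)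
    ...   | inj₁ refl = subst (_∈ ⁅ v ⁆ ∪ ⁅ z ⁆) (trans (sym px) pa) pairʳ
    ...   | inj₂ refl = subst (_∈ ⁅ v ⁆ ∪ ⁅ z ⁆) (trans (sym py) pa) pairˡ
    from : ∀ w → w ∈ ⁅ v ⁆ ∪ ⁅ z ⁆ → w ∈ inc G₀ (φ₀ f)
    from w m with ∈pair m
    ... | inj₁ refl = subst (_∈ inc G₀ (φ₀ f)) py (φ-inside c f y (subst (y ∈_) (sym eq) pairʳ))
    ... | inj₂ refl = subst (_∈ inc G₀ (φ₀ f)) px (φ-inside c f x (subst (x ∈_) (sym eq) pairˡ))

  -- The neighbours of x in X_v are joined to x by edges of distinct
  -- matchings; so if all of these matchings belong to E', there are at
  -- most |E'| of them.
  neighbours-≤ : ∀ {v x} → (E' : Subset (nE G₀)) →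
    (∀ y h → y ∈ N H₀ x ∩ X c v → inc H₀ h ≡ (⁅ x ⁆ ∪ ⁅ y ⁆) → φ₀ h ∈ E') → ∣ N H₀ x ∩ X c v ∣ ≤ ∣ E' ∣
  neighbours-≤ {v} {x} E' hyp = card-≤-injection (N H₀ x ∩ X c v) E' (λ y e → ∃ λ f → φ₀ f ≡ e × inc H₀ f ≡ (⁅ x ⁆ ∪ ⁅ y ⁆)) image injective
    where
    image : ∀ y → y ∈ N H₀ x ∩ X c v → ∃ λ e → e ∈ E' × ∃ λ f → φ₀ f ≡ e × inc H₀ f ≡ (⁅ x ⁆ ∪ ⁅ y ⁆)
    image y m with N⁻ (∈∩⁻ˡ m)
    ... | f , eq = φ₀ f , hyp y f m eq , f , refl , eq
    injective : ∀ y y' e → y ∈ N H₀ x ∩ X c v → y' ∈ N H₀ x ∩ X c v →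
      (∃ λ f → φ₀ f ≡ e × inc H₀ f ≡ (⁅ x ⁆ ∪ ⁅ y ⁆)) → (∃ λ f → φ₀ f ≡ e × inc H₀ f ≡ (⁅ x ⁆ ∪ ⁅ y' ⁆)) → y ≡ y'
    injective y y' e m m' (f , fe , eq) (f' , fe' , eq') =
      meet-unique f v y y' (subst (_∈ inc G₀ (φ₀ f)) py (φ-inside c f y y∈f)) y∈f (subst (λ g → y' ∈ inc H₀ g) (sym f≡f') y'∈f') py py'
      where
      py = X⁻ (∈∩⁻ʳ {p = N H₀ x} m)
      py' = X⁻ (∈∩⁻ʳ {p = N H₀ x} m')
      y∈f = subst (y ∈_) (sym eq) pairʳ
      y'∈f' = subst (y' ∈_) (sym eq') pairʳ
      f≡f' : f ≡ f'
      f≡f' = matching-unique f f' x (trans fe (sym fe')) (subst (x ∈_) (sym eq) pairˡ) (subst (x ∈_) (sym eq') pairˡ)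

  neighbours-≤-μ : ∀ {z v x} → x ∈ X c z → ∣ N H₀ x ∩ X c v ∣ ≤ μ G₀ v z
  neighbours-≤-μ {z} {v} {x} xm = neighbours-≤ (Mult v z) (λ y h m eq → Mult⁺ (pair-image eq (X⁻ xm) (X⁻ (∈∩⁻ʳ {p = N H₀ x} m))))

  -- If z does not separate, every u ≠ z has a walk to v avoiding z: the
  -- vertices reachable from v in G − z and the rest (plus z) would
  -- otherwise witness that z is a separating vertex.
  module Separation (z v : Fin nv) (v≢z : v ≢ z) where
    Rel : Fin nv → Fin nv → Set
    Rel a b = a ≢ z × b ≢ z × ∃ λ e → a ∈ inc G₀ e × b ∈ inc G₀ e

    rel? : ∀ a b → Dec (Rel a b)
    rel? a b = ¬? (a ≟ z) ×-dec (¬? (b ≟ z) ×-dec FinP.any? (λ e → (a ∈? inc G₀ e) ×-dec (b ∈? inc G₀ e)))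

    open Closure Rel rel?

    Cv = Rc ⁅ v ⁆

    avoids-z : ∀ {a b} → Star Rel a b → a ≢ z → b ≢ z
    avoids-z ε n = n
    avoids-z ((_ , bz , _) ◅ st) n = avoids-z st bz

    z∉Cv : z ∉ Cv
    z∉Cv m = avoids-z (Rc-single⁻ m) v≢z refl

    to-steps : ∀ {a b} → Star Rel a b → Star (Step ⁅ z ⁆) a b
    to-steps ε = ε
    to-steps ((az , bz , e , ae , be) ◅ st) = ((λ m → az (∈⁅⁆ m)) , e , ae , be) ◅ to-steps st

    reverse : ∀ {a b} → Star Rel a b → Star Rel b a
    reverse = Star.reverse (λ { (az , bz , e , ae , be) → bz , az , e , be , ae })

    separation : ∀ u → u ≢ z → u ∉ Cv → IsSeparating G₀ (whole G₀) z
    separation u u≢z u∉Cv =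
      Y₁ , Y₂ , (λ _ → ∈⊤) , (λ _ → ∈⊤) , subset-ext (λ _ _ → ∈⊤) covers , subset-ext meet₁ meet₂ ,
      card≥2 {x = v} {y = z} (∈∪ˡ (Rc-single⁺ ε)) (∈∪ʳ {p = Cv} (x∈⁅x⁆ z)) v≢z ,
      card≥2 {x = u} {y = z} (x∉p⇒x∈∁p u∉Cv) (x∉p⇒x∈∁p z∉Cv) u≢z , edges
      where
      Y₁ = Cv ∪ ⁅ z ⁆
      Y₂ = ∁ Cv
      covers : ∀ w → w ∈ ⊤ → w ∈ Y₁ ∪ Y₂
      covers w _ with w ∈? Cv
      ... | yes m = ∈∪ˡ (∈∪ˡ m)
      ... | no m = ∈∪ʳ {p = Y₁} (x∉p⇒x∈∁p m)
      meet₁ : ∀ w → w ∈ Y₁ ∩ Y₂ → w ∈ ⁅ z ⁆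
      meet₁ w m with ∈∪⁻ {p = Cv} (∈∩⁻ˡ m)
      ... | inj₁ x = ⊥-elim (x∈∁p⇒x∉p (∈∩⁻ʳ {p = Y₁} m) x)
      ... | inj₂ x = x
      meet₂ : ∀ w → w ∈ ⁅ z ⁆ → w ∈ Y₁ ∩ Y₂
      meet₂ w m rewrite ∈⁅⁆ m = ∈∩ (∈∪ʳ {p = Cv} (x∈⁅x⁆ z)) (x∉p⇒x∈∁p z∉Cv)
      edges : ∀ e → e ∈ ⊤ → (inc G₀ e ⊆ Y₁) ⊎ (inc G₀ e ⊆ Y₂)
      edges e _ with FinP.any? (λ w → (w ∈? inc G₀ e) ×-dec (w ∈? Cv))
      ... | yes (w₀ , w₀e , w₀C) = inj₁ (λ {a} am → in-Y₁ a am)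
        where
        in-Y₁ : ∀ a → a ∈ inc G₀ e → a ∈ Y₁
        in-Y₁ a am with a ≟ z
        ... | yes refl = ∈∪ʳ {p = Cv} (x∈⁅x⁆ a)
        ... | no az = ∈∪ˡ (Rc-closed ⁅ v ⁆ w₀C (avoids-z (Rc-single⁻ w₀C) v≢z , az , e , w₀e , am))
      ... | no none = inj₂ (λ {a} am → x∉p⇒x∈∁p (λ aC → none (a , am , aC)))

    walk-or-separating : ∀ u → u ≢ z → Star (Step ⁅ z ⁆) u v ⊎ IsSeparating G₀ (whole G₀) z
    walk-or-separating u u≢z with u ∈? Cv
    ... | yes m = inj₁ (to-steps (reverse (Rc-single⁻ m)))
    ... | no u∉Cv = inj₂ (separation u u≢z u∉Cv)

  blocking-pair : ∀ {P T u y f x z} → Partial P T → (uP : u ∉ P) → π₀ y ≡ u → inc H₀ f ⊆' (T ∪ ⁅ y ⁆) →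
    x ∈ T → π₀ x ≡ z → u ≢ z → inc G₀ (φ₀ f) ≡ ⁅ u ⁆ ∪ ⁅ z ⁆ → inc H₀ f ≡ ⁅ x ⁆ ∪ ⁅ y ⁆
  blocking-pair {P} {T} {u} {y} {f} {x} {z} s uP py sb xT px u≢z eq = subset-ext to from
    where
    module Bf = BlockingEdge {P} {T} {u} {y} {f} s uP py sb
    over-z : ∀ a → a ∈ inc H₀ f → π₀ a ≡ z → a ≡ x
    over-z a am pa = one-per-class s a x (Bf.inT a am (λ e → u≢z (trans (sym e) pa))) xT (trans pa (sym px))
    to : ∀ a → a ∈ inc H₀ f → a ∈ ⁅ x ⁆ ∪ ⁅ y ⁆
    to a am with ∈pair (subst (π₀ a ∈_) eq (φ-inside c f a am))
    ... | inj₁ pu = subst (_∈ ⁅ x ⁆ ∪ ⁅ y ⁆) (sym (meet-unique f u a y (subst (u ∈_) (sym eq) pairˡ) am Bf.y∈f pu py)) pairʳ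
    ... | inj₂ pz = subst (_∈ ⁅ x ⁆ ∪ ⁅ y ⁆) (sym (over-z a am pz)) pairˡ
    from : ∀ a → a ∈ ⁅ x ⁆ ∪ ⁅ y ⁆ → a ∈ inc H₀ f
    from a m with ∈pair m
    ... | inj₂ refl = Bf.y∈f
    ... | inj₁ refl with meet-exists f z (subst (z ∈_) (sym eq) pairʳ)
    ...   | b , bm , pb = subst (_∈ inc H₀ f) (over-z b bm pb) bm

  -- Colour x, then everything but v (possible as
  -- z does not separate).  A vertex y ∈ X_v outside N_H(x) is blocked only
  -- through edges at v other than the {v,z}-edges; counting the neighbours
  -- of x and these blocked vertices, fewer than d(v) ≤ |X_v| vertices of X_v
  -- are excluded when |N_H(x) ∩ X_v| < μ(v,z), so v can be coloured.
  module LowerBound (unc : Uncolorable C) (z : Fin nv) (nsep : ¬ IsSeparating G₀ (whole G₀) z)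
                    (v : Fin nv) (v≢z : v ≢ z) (x : Fin nh) (xm : x ∈ X c z)
                    (few : ∣ N H₀ x ∩ X c v ∣ < μ G₀ v z) where
    start : Partial ⁅ z ⁆ (⊥ ∪ ⁅ x ⁆)
    start = Partial-resp (λ w m → [ (λ q → ⊥-elim (∉⊥ q)) , (λ q → q) ]′ (∈∪⁻ {p = ⊥} m)) (λ w m → ∈∪ʳ {p = ⊥} m)
              (extend Partial-empty ∉⊥ (X⁻ xm) (addable-to-empty x))

    walks : ∀ u → u ∉ ⁅ z ⁆ → ∃ λ r → r ∈ ⁅ v ⁆ × Star (Step ⁅ z ⁆) u r
    walks u u∉z = v , x∈⁅x⁆ v , [ (λ w → w) , (λ sp → ⊥-elim (nsep sp)) ]′
      (Separation.walk-or-separating z v v≢z u (λ eq → u∉z (subst (_∈ ⁅ z ⁆) (sym eq) (x∈⁅x⁆ z))))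

    -- kept opaque: only the properties of this colouring matter
    opaque
      coloured-but-v : ∃ λ T' → Partial (∁ ⁅ v ⁆) T' × (⊥ ∪ ⁅ x ⁆) ⊆' T'
      coloured-but-v = colour-towards start ⁅ v ⁆ (λ r rm rz → v≢z (trans (sym (∈⁅⁆ rm)) (∈⁅⁆ rz))) walks
    T = proj₁ coloured-but-v
    s = proj₁ (proj₂ coloured-but-v)
    xT : x ∈ T
    xT = proj₂ (proj₂ coloured-but-v) x (∈∪ʳ {p = ⊥} (x∈⁅x⁆ x))

    Other = edgesAt G₀ v ∩ ∁ (Mult v z)

    non-neighbour-blocking : ∀ y f → y ∈ ∁ (N H₀ x) → π₀ y ≡ v → inc H₀ f ⊆' (T ∪ ⁅ y ⁆) → φ₀ f ∈ Other
    non-neighbour-blocking y f yN py sb = ∈∩ (∈⟦d⟧⁺ {d = λ e → v ∈? inc G₀ e} Bf.u∈e) (x∉p⇒x∈∁p not-vz)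
      where
      module Bf = BlockingEdge {∁ ⁅ v ⁆} {T} {v} {y} {f} s (∉∁⁅⁆ v) py sb
      not-vz : φ₀ f ∉ Mult v z
      not-vz m = x∈∁p⇒x∉p yN (N⁺ {x} {y} (f , blocking-pair s (∉∁⁅⁆ v) py sb xT (X⁻ xm) v≢z (Mult⁻ m)))

    Excluded = (N H₀ x ∩ X c v) ∪ (Blocked T v ∩ ∁ (N H₀ x))

    few-excluded : ∣ Excluded ∣ < ∣ X c v ∣
    few-excluded = begin-strict
        ∣ Excluded ∣                                         ≤⟨ card-∪ (N H₀ x ∩ X c v) (Blocked T v ∩ ∁ (N H₀ x)) ⟩
        ∣ N H₀ x ∩ X c v ∣ + ∣ Blocked T v ∩ ∁ (N H₀ x) ∣    ≤⟨ +-monoʳ-≤ ∣ N H₀ x ∩ X c v ∣ (blocked-count s (∉∁⁅⁆ v) (∁ (N H₀ x)) Other non-neighbour-blocking) ⟩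
        ∣ N H₀ x ∩ X c v ∣ + ∣ Other ∣                       <⟨ +-monoˡ-< ∣ Other ∣ few ⟩
        μ G₀ v z + ∣ Other ∣                                 ≤⟨ +-monoˡ-≤ ∣ Other ∣ (p⊆q⇒∣p∣≤∣q∣ {p = Mult v z} (λ m → ∈∩ (Mult⊆edgesAt v z m) m)) ⟩
        ∣ edgesAt G₀ v ∩ Mult v z ∣ + ∣ Other ∣              ≡⟨ card-split (edgesAt G₀ v) (Mult v z) ⟩
        deg G₀ v                                             ≤⟨ df v ⟩
        ∣ X c v ∣                                            ∎
      where open ≤-Reasoning

    contradiction : Void
    contradiction with ∃-outside Excluded (X c v) few-excluded
    ... | y , ym , y∉Ex = unc (finish-colouring s (X⁻ ym) addable)
      where
      addable : Addable T y
      addable f sb = case-dec (y ∈? N H₀ x) (λ yN → y∉Ex (∈∪ˡ (∈∩ yN ym)))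
        (λ yN → y∉Ex (∈∪ʳ {p = N H₀ x ∩ X c v} (∈∩ (∈∩ ym (∈⟦d⟧⁺ {d = blocked? T} (f , (λ {a} → sb a)))) (x∉p⇒x∈∁p yN))))

  part-b : Uncolorable C → ∀ z → ¬ IsSeparating G₀ (whole G₀) z → ∀ v → v ≢ z →
         ∀ x → x ∈ X c z → ∣ N H₀ x ∩ X c v ∣ ≡ μ G₀ v z
  part-b unc z nsep v v≢z x xm with ∣ N H₀ x ∩ X c v ∣ <? μ G₀ v z
  ... | no ≮ = ≤-antisym (neighbours-≤-μ xm) (≮⇒≥ ≮)
  ... | yes few = ⊥-elim (LowerBound.contradiction unc z nsep v v≢z x xm few)

  module Detour (e : Fin (nE G₀)) where
    OutsideStep : Fin nv → Fin nv → Set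
    OutsideStep t t' = t ∉ inc G₀ e × ∃ λ f → f ≢ e × t ∈ inc G₀ f × t' ∈ inc G₀ f

    record Chord : Set where
      field
        q r p : Fin nv
        e₀ : Fin (nE G₀)
        q∈e : q ∈ inc G₀ e
        r∈e : r ∈ inc G₀ e
        q≢r : q ≢ r
        e₀≢e : e₀ ≢ e
        q∈e₀ : q ∈ inc G₀ e₀
        p∈e₀ : p ∈ inc G₀ e₀
        p≢q : p ≢ q
        walk : Star OutsideStep p r

    -- progress along a walk in G − e starting at b ∈ e: either still at b,
    -- or a chord from b has been started and is currently at s ∉ e
    State : Fin nv → Fin nv → Set
    State b s = (s ≡ b) ⊎ (s ∉ inc G₀ e × ∃ λ e₀ → ∃ λ p → e₀ ≢ e × b ∈ inc G₀ e₀ × p ∈ inc G₀ e₀ × p ≢ b × Star OutsideStep p s)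

    ∈∁⁅e⁆⇒≢ : ∀ {f} → f ∈ ∁ ⁅ e ⁆ → f ≢ e
    ∈∁⁅e⁆⇒≢ m eq = x∈∁p⇒x∉p m (subst (_∈ ⁅ e ⁆) (sym eq) (x∈⁅x⁆ e))

    -- a walk in G − e between distinct vertices b, a of e contains a chord:
    -- follow it from (the last visit of) b to its first return to e
    find-chord : ∀ {b s a} → b ∈ inc G₀ e → a ∈ inc G₀ e → a ≢ b → State b s → Star (Adj G₀ (minusEdge G₀ e)) s a → Chord
    find-chord be ae ab (inj₁ refl) ε = ⊥-elim (ab refl)
    find-chord be ae ab (inj₂ (se , _)) ε = ⊥-elim (se ae)
    find-chord {b} {s} {a} be ae ab st (_◅_ {j = x} (f , fm , sf , xf) rest) with x ≟ b
    ... | yes refl = find-chord be ae ab (inj₁ refl) rest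
    ... | no xb with x ∈? inc G₀ e | st
    ...   | yes xe | inj₁ refl = record
      { q = b ; r = x ; e₀ = f ; p = x ; q∈e = be ; r∈e = xe ; q≢r = λ eq → xb (sym eq)
      ; e₀≢e = ∈∁⁅e⁆⇒≢ fm ; q∈e₀ = sf ; p∈e₀ = xf ; p≢q = xb ; walk = ε }
    ...   | yes xe | inj₂ (se , e₀ , p , e₀e , be₀ , pe₀ , pb , w) = record
      { q = b ; r = x ; e₀ = e₀ ; p = p ; q∈e = be ; r∈e = xe ; q≢r = λ eq → xb (sym eq)
      ; e₀≢e = e₀e ; q∈e₀ = be₀ ; p∈e₀ = pe₀ ; p≢q = pb ; walk = w ◅◅ ((se , f , ∈∁⁅e⁆⇒≢ fm , sf , xf) ◅ ε) }
    ...   | no xe | inj₁ refl = find-chord be ae ab (inj₂ (xe , f , x , ∈∁⁅e⁆⇒≢ fm , sf , xf , xb , ε)) rest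
    ...   | no xe | inj₂ (se , e₀ , p , e₀e , be₀ , pe₀ , pb , w) =
      find-chord be ae ab (inj₂ (xe , e₀ , p , e₀e , be₀ , pe₀ , pb , w ◅◅ ((se , f , ∈∁⁅e⁆⇒≢ fm , sf , xf) ◅ ε))) rest

    -- Let J be the
    -- set of vertices with an outside walk to r (so J ∩ e = {r}, p ∈ J)
    -- and w ∈ e a third vertex.
    --  1. colour everything outside J ∪ {q}, in particular w (colour t_w);
    --  2. colour q by some t_q not matched to t_w in M_e: neither e nor e₀
    --     is full at q, so |X_q| exceeds the number of blocked vertices by 2;
    --  3. colour J ∖ {r}, towards r;
    --  4. colour r: M_e cannot block, as its edge through t_q misses t_w,
    --     and the other d(r) − 1 < |X_r| edges at r block too few.
    module Recolour (unc : Uncolorable C) (he : 3 ≤ ∣ inc G₀ e ∣) (chord : Chord) where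
      open Chord chord

      InStep : Fin nv → Fin nv → Set
      InStep a b = OutsideStep b a

      in-step? : ∀ a b → Dec (InStep a b)
      in-step? a b = ¬? (b ∈? inc G₀ e) ×-dec FinP.any? (λ f → ¬? (f ≟ e) ×-dec ((b ∈? inc G₀ f) ×-dec (a ∈? inc G₀ f)))

      module J-closure = Closure InStep in-step?

      J : Subset nv
      J = J-closure.Rc ⁅ r ⁆

      J⁻ : ∀ {t} → t ∈ J → Star OutsideStep t r
      J⁻ m = Star.reverse (λ x → x) (J-closure.Rc-single⁻ m)

      J⁺ : ∀ {t} → Star OutsideStep t r → t ∈ J
      J⁺ w = J-closure.Rc-single⁺ (Star.reverse (λ x → x) w)

      J-outside-e : ∀ {t} → t ∈ J → t ≢ r → t ∉ inc G₀ e
      J-outside-e m with J⁻ m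
      ... | ε = λ t≢r → ⊥-elim (t≢r refl)
      ... | st ◅ _ = λ _ → proj₁ st

      r∈J : r ∈ J
      r∈J = J⁺ ε

      p∈J : p ∈ J
      p∈J = J⁺ walk

      q∉J : q ∉ J
      q∉J m = J-outside-e m q≢r q∈e

      third = ∃-third (inc G₀ e) q r he
      w = proj₁ third
      w∈e = proj₁ (proj₂ third)
      w≢q = proj₁ (proj₂ (proj₂ third))
      w≢r = proj₂ (proj₂ (proj₂ third))

      P₁ = ∁ (J ∪ ⁅ q ⁆)

      opaque
        phase₁ : ∃ λ T' → Partial P₁ T' × ⊥ ⊆' T'
        phase₁ = colour-towards Partial-empty (J ∪ ⁅ q ⁆) (λ _ _ → ∉⊥)
          (λ u _ → r , ∈∪ˡ r∈J , [ (λ x → x) , (λ { (_ , m , _) → ⊥-elim (∉⊥ m) }) ]′ (walk-or-coloured u r))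

      T₁ = proj₁ phase₁
      s₁ : Partial P₁ T₁
      s₁ = proj₁ (proj₂ phase₁)

      w∈P₁ : w ∈ P₁
      w∈P₁ = x∉p⇒x∈∁p (λ m → [ (λ w∈J → J-outside-e w∈J w≢r w∈e) , (λ x → w≢q (∈⁅⁆ x)) ]′ (∈∪⁻ {p = J} m))

      q∉P₁ : q ∉ P₁
      q∉P₁ m = x∈∁p⇒x∉p m (∈∪ʳ {p = J} (x∈⁅x⁆ q))

      colour-w = coloured s₁ w w∈P₁
      t-w = proj₁ colour-w
      t-w∈T₁ = proj₁ (proj₂ colour-w)
      πt-w = proj₂ (proj₂ colour-w)

      Partner : Fin nh → Set
      Partner y = ∃ λ f → φ₀ f ≡ e × y ∈ inc H₀ f × t-w ∈ inc H₀ f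

      partner? : ∀ y → Dec (Partner y)
      partner? y = FinP.any? (λ f → (φ₀ f ≟ e) ×-dec ((y ∈? inc H₀ f) ×-dec (t-w ∈? inc H₀ f)))

      Partners = X c q ∩ ⟦ (λ y → does (partner? y)) ⟧

      partner-unique : ∀ {y y'} → π₀ y ≡ q → π₀ y' ≡ q → Partner y → Partner y' → y ≡ y'
      partner-unique {y} {y'} py py' (f , fe , yf , twf) (f' , fe' , yf' , twf') =
        meet-unique f q y y' (subst (λ g → q ∈ inc G₀ g) (sym fe) q∈e) yf (subst (λ g → y' ∈ inc H₀ g) (sym f≡f') yf') py py'
        where
        f≡f' : f ≡ f'
        f≡f' = matching-unique f f' t-w (trans fe (sym fe')) twf twf'

      partners-≤1 : ∣ Partners ∣ ≤ 1
      partners-≤1 = ≤-trans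
        (card-≤-injection Partners ⁅ t-w ⁆ (λ y _ → Partner y)
           (λ y m → t-w , x∈⁅x⁆ t-w , ∈⟦d⟧⁻ {d = partner?} (∈∩⁻ʳ {p = X c q} m))
           (λ y y' _ m m' → partner-unique (X⁻ (∈∩⁻ˡ m)) (X⁻ (∈∩⁻ˡ m'))))
        (≤-reflexive (∣⁅x⁆∣≡1 t-w))

      -- e and e₀ are not full at q: they contain r resp. p, both in J
      full⊆ : Full P₁ q ⊆ (edgesAt G₀ q - e) - e₀
      full⊆ {e'} m = x∈p∧x≢y⇒x∈p-y (x∈p∧x≢y⇒x∈p-y (∈∩⁻ˡ m) (not-full r r∈e q≢r r∈J)) (not-full p p∈e₀ (λ z → p≢q (sym z)) p∈J)
        where
        e'⊆ : inc G₀ e' ⊆ P₁ ∪ ⁅ q ⁆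
        e'⊆ = ∈⟦d⟧⁻ {d = λ e → inc G₀ e ⊆? (P₁ ∪ ⁅ q ⁆)} (∈∩⁻ʳ {p = edgesAt G₀ q} m)
        not-full : ∀ t {g} → t ∈ inc G₀ g → q ≢ t → t ∈ J → e' ≢ g
        not-full t tg qt tJ refl = [ (λ z → x∈∁p⇒x∉p z (∈∪ˡ tJ)) , (λ z → qt (sym (∈⁅⁆ z))) ]′ (∈∪⁻ {p = P₁} (e'⊆ tg))

      full-two-fewer : ∣ Full P₁ q ∣ + 2 ≤ deg G₀ q
      full-two-fewer = begin
        ∣ Full P₁ q ∣ + 2                ≤⟨ +-monoˡ-≤ 2 (p⊆q⇒∣p∣≤∣q∣ full⊆) ⟩
        ∣ (edgesAt G₀ q - e) - e₀ ∣ + 2  ≡⟨ +-comm _ 2 ⟩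
        2 + ∣ (edgesAt G₀ q - e) - e₀ ∣  ≤⟨ s≤s (x∈p⇒∣p-x∣<∣p∣ (x∈p∧x≢y⇒x∈p-y (at-q q∈e₀) e₀≢e)) ⟩
        1 + ∣ edgesAt G₀ q - e ∣         ≤⟨ x∈p⇒∣p-x∣<∣p∣ (at-q q∈e) ⟩
        deg G₀ q                         ∎
        where
        open ≤-Reasoning
        at-q : ∀ {g} → q ∈ inc G₀ g → g ∈ edgesAt G₀ q
        at-q = ∈⟦d⟧⁺ {d = λ g → q ∈? inc G₀ g}

      few-excluded : ∣ Blocked T₁ q ∪ Partners ∣ < ∣ X c q ∣
      few-excluded = begin-strict
        ∣ Blocked T₁ q ∪ Partners ∣        ≤⟨ card-∪ (Blocked T₁ q) Partners ⟩
        ∣ Blocked T₁ q ∣ + ∣ Partners ∣    ≤⟨ +-monoʳ-≤ ∣ Blocked T₁ q ∣ partners-≤1 ⟩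
        ∣ Blocked T₁ q ∣ + 1               <⟨ +-monoʳ-< ∣ Blocked T₁ q ∣ (n<1+n 1) ⟩
        ∣ Blocked T₁ q ∣ + 2               ≤⟨ +-monoˡ-≤ 2 (blocked-count-all s₁ q∉P₁ (Full P₁ q) (blocking-edge-full s₁ q∉P₁)) ⟩
        ∣ Full P₁ q ∣ + 2                  ≤⟨ full-two-fewer ⟩
        deg G₀ q                           ≤⟨ df q ⟩
        ∣ X c q ∣                          ∎
        where open ≤-Reasoning

      opaque
        colour-q : ∃ λ y → y ∈ X c q × y ∉ Blocked T₁ q ∪ Partners
        colour-q = ∃-outside (Blocked T₁ q ∪ Partners) (X c q) few-excluded

      t-q = proj₁ colour-q
      πt-q : π₀ t-q ≡ q
      πt-q = X⁻ (proj₁ (proj₂ colour-q))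

      t-q-not-partner : ¬ Partner t-q
      t-q-not-partner pt = proj₂ (proj₂ colour-q) (∈∪ʳ {p = Blocked T₁ q} (∈∩ (proj₁ (proj₂ colour-q)) (∈⟦d⟧⁺ {d = partner?} pt)))

      s₂ : Partial (P₁ ∪ ⁅ q ⁆) (T₁ ∪ ⁅ t-q ⁆)
      s₂ = extend s₁ q∉P₁ πt-q (addable-if-unblocked (proj₁ (proj₂ colour-q)) (λ z → proj₂ (proj₂ colour-q) (∈∪ˡ z)))

      -- step 3: the uncoloured vertices lie in J and reach r by outside walks
      J-uncoloured : ∀ {t} → t ∈ J → t ≢ q → t ∉ P₁ ∪ ⁅ q ⁆
      J-uncoloured tJ t≢q m = [ (λ z → x∈∁p⇒x∉p z (∈∪ˡ tJ)) , (λ z → t≢q (∈⁅⁆ z)) ]′ (∈∪⁻ {p = P₁} m)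

      to-steps : ∀ {t} → Star OutsideStep t r → t ∈ J → t ≢ q → Star (Step (P₁ ∪ ⁅ q ⁆)) t r
      to-steps ε _ _ = ε
      to-steps ((_ , f , _ , tf , t'f) ◅ rest) tJ t≢q =
        (J-uncoloured tJ t≢q , f , tf , t'f) ◅ to-steps rest (J⁺ rest) (λ eq → q∉J (subst (_∈ J) eq (J⁺ rest)))

      walks₃ : ∀ u → u ∉ P₁ ∪ ⁅ q ⁆ → ∃ λ t → t ∈ ⁅ r ⁆ × Star (Step (P₁ ∪ ⁅ q ⁆)) u t
      walks₃ u uP = r , x∈⁅x⁆ r , to-steps (J⁻ u∈J) u∈J u≢q
        where
        u≢q : u ≢ q
        u≢q eq = uP (∈∪ʳ {p = P₁} (subst (_∈ ⁅ q ⁆) (sym eq) (x∈⁅x⁆ q)))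
        u∈J : u ∈ J
        u∈J = decidable-stable (u ∈? J) (λ u∉J → uP (∈∪ˡ (x∉p⇒x∈∁p (λ m → [ u∉J , (λ z → u≢q (∈⁅⁆ z)) ]′ (∈∪⁻ {p = J} m)))))

      opaque
        phase₃ : ∃ λ T' → Partial (∁ ⁅ r ⁆) T' × (T₁ ∪ ⁅ t-q ⁆) ⊆' T'
        phase₃ = colour-towards s₂ ⁅ r ⁆ (λ t tm → subst (_∉ P₁ ∪ ⁅ q ⁆) (sym (∈⁅⁆ tm)) (J-uncoloured r∈J (λ z → q≢r (sym z)))) walks₃

      T₃ = proj₁ phase₃
      s₃ : Partial (∁ ⁅ r ⁆) T₃
      s₃ = proj₁ (proj₂ phase₃)
      t-q∈T₃ : t-q ∈ T₃
      t-q∈T₃ = proj₂ (proj₂ phase₃) t-q (∈∪ʳ {p = T₁} (x∈⁅x⁆ t-q))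
      t-w∈T₃ : t-w ∈ T₃
      t-w∈T₃ = proj₂ (proj₂ phase₃) t-w (∈∪ˡ t-w∈T₁)

      -- step 4: an M_e-edge blocking at r would pass through t_q and t_w
      not-by-e : ∀ y f → π₀ y ≡ r → inc H₀ f ⊆' (T₃ ∪ ⁅ y ⁆) → φ₀ f ∈ edgesAt G₀ r - e
      not-by-e y f py sb = x∈p∧x≢y⇒x∈p-y (∈⟦d⟧⁺ {d = λ g → r ∈? inc G₀ g} Bf.u∈e) φf≢e
        where
        module Bf = BlockingEdge {∁ ⁅ r ⁆} {T₃} {r} {y} {f} s₃ (∉∁⁅⁆ r) py sb
        φf≢e : φ₀ f ≢ e
        φf≢e eq with Bf.over q (subst (λ g → q ∈ inc G₀ g) (sym eq) q∈e) q≢r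
                   | Bf.over w (subst (λ g → w ∈ inc G₀ g) (sym eq) w∈e) w≢r
        ... | a , af , aT , πa | b , bf , bT , πb = t-q-not-partner
          (f , eq , subst (_∈ inc H₀ f) (one-per-class s₃ a t-q aT t-q∈T₃ (trans πa (sym πt-q))) af
                  , subst (_∈ inc H₀ f) (one-per-class s₃ b t-w bT t-w∈T₃ (trans πb (sym πt-w))) bf)

      opaque
        colour-r : ∃ λ y → π₀ y ≡ r × Addable T₃ y
        colour-r = choose-addable s₃ (∉∁⁅⁆ r) (edgesAt G₀ r - e) not-by-e
          (≤-trans (x∈p⇒∣p-x∣<∣p∣ (∈⟦d⟧⁺ {d = λ g → r ∈? inc G₀ g} r∈e)) (df r))

      contradiction : Void
      contradiction = unc (finish-colouring s₃ (proj₁ (proj₂ colour-r)) (proj₂ (proj₂ colour-r)))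

  no-detour : Uncolorable C → ∀ e → 3 ≤ ∣ inc G₀ e ∣ → ∀ a b → a ∈ inc G₀ e → b ∈ inc G₀ e → a ≢ b →
    ¬ Joined G₀ (minusEdge G₀ e) b a
  no-detour unc e he a b ae be ab j = Detour.Recolour.contradiction e unc he (Detour.find-chord e be ae ab (inj₁ refl) j)

module Structure (C : Configuration) (df : DegreeFeasible C) (unc : Uncolorable C) where
  open Colouring C df

  -- Part (c) for a hyperedge e.  By no-detour, every component of G − e
  -- contains exactly one vertex of e, its "root".
  module Hyperedge (e : Fin (nE G₀)) (he : 3 ≤ ∣ inc G₀ e ∣) where
    Joined⁻ = Joined G₀ (minusEdge G₀ e)

    reverse⁻ : ∀ {u v} → Joined⁻ u v → Joined⁻ v u
    reverse⁻ = Star.reverse (λ { (f , fm , a , b) → f , fm , b , a })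

    joined⁻-in-e : ∀ {a b} → a ∈ inc G₀ e → b ∈ inc G₀ e → Joined⁻ a b → a ≡ b
    joined⁻-in-e {a} {b} ae be j = decidable-stable (a ≟ b) (λ ne → no-detour unc e he b a be ae (λ eq → ne (sym eq)) j)

    enter-e : ∀ {y t} → Star (Adj G₀ (whole G₀)) y t → t ∈ inc G₀ e → ∃ λ w → w ∈ inc G₀ e × Joined⁻ y w
    enter-e {t = t} ε te = t , te , ε
    enter-e {y} ((f , _ , yf , xf) ◅ rest) te with f ≟ e
    ... | yes refl = y , yf , ε
    ... | no ne with enter-e rest te
    ...   | w , we , j = w , we , (f , ≢⇒∈∁⁅⁆ ne , yf , xf) ◅ j

    some-vertex = ∃-member (inc G₀ e) (≤-trans (s≤s z≤n) he)
    t₀ = proj₁ some-vertex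

    to-root : ∀ y → ∃ λ w → w ∈ inc G₀ e × Joined⁻ y w
    to-root y = enter-e (connected C y t₀ ∈⊤ ∈⊤) (proj₂ some-vertex)

    root : Fin nv → Fin nv
    root y = proj₁ (to-root y)

    root∈e : ∀ y → root y ∈ inc G₀ e
    root∈e y = proj₁ (proj₂ (to-root y))

    joined-root : ∀ y → Joined⁻ y (root y)
    joined-root y = proj₂ (proj₂ (to-root y))

    root-joined : ∀ {t t'} → Joined⁻ t t' → root t ≡ root t'
    root-joined {t} {t'} j = joined⁻-in-e (root∈e t) (root∈e t') (reverse⁻ (joined-root t) ◅◅ j ◅◅ joined-root t')

    root-fix : ∀ {t} → t ∈ inc G₀ e → root t ≡ t
    root-fix {t} te = joined⁻-in-e (root∈e t) te (reverse⁻ (joined-root t))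

    same-root : ∀ {f t a} → f ≢ e → t ∈ inc G₀ f → a ∈ inc G₀ f → root t ≡ root a
    same-root {f} f≢e tf af = root-joined ((f , ≢⇒∈∁⁅⁆ f≢e , tf , af) ◅ ε)

    -- the components of G − e, labelled by the position of their root in e
    size-1 = ∣ inc G₀ e ∣ ∸ 1

    size≡ : ∣ inc G₀ e ∣ ≡ 1 + size-1
    size≡ = sym (m+[n∸m]≡n (≤-trans (s≤s z≤n) he))

    label : Fin nv → Fin (1 + size-1)
    label y = subst Fin size≡ (idx (inc G₀ e) (root y) (root∈e y))

    subst-Fin-injective : ∀ {m n} (eq : m ≡ n) {a b : Fin m} → subst Fin eq a ≡ subst Fin eq b → a ≡ b
    subst-Fin-injective refl e = e

    subst-Fin-inverse : ∀ {m n} (eq : m ≡ n) (j : Fin n) → subst Fin eq (subst Fin (sym eq) j) ≡ j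
    subst-Fin-inverse refl j = refl

    components-minus-e : HasComponents G₀ (minusEdge G₀ e) (1 + size-1)
    components-minus-e = label , onto , same-label⇔joined
      where
      onto : ∀ j → ∃ λ u → u ∈ ⊤ × label u ≡ j
      onto j with idx-surjective (inc G₀ e) (subst Fin (sym size≡) j)
      ... | x , m , ix = x , ∈⊤ ,
        trans (cong (subst Fin size≡) (trans (idx-cong (inc G₀ e) (root∈e x) m (root-fix m)) ix)) (subst-Fin-inverse size≡ j)
      same-label⇔joined : ∀ u v → u ∈ ⊤ → v ∈ ⊤ → (label u ≡ label v) ⇔ Joined⁻ u v
      same-label⇔joined u v _ _ = mk⇔ to from
        where
        to : label u ≡ label v → Joined⁻ u v
        to eq = joined-root u ◅◅ subst (λ z → Joined⁻ z v) (sym roots-equal) (reverse⁻ (joined-root v))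
          where
          roots-equal : root u ≡ root v
          roots-equal = idx-injective (inc G₀ e) (root∈e u) (root∈e v) (subst-Fin-injective size≡ eq)
        from : Joined⁻ u v → label u ≡ label v
        from j = cong (subst Fin size≡) (idx-cong (inc G₀ e) (root∈e u) (root∈e v) (root-joined j))

    components-whole : HasComponents G₀ (whole G₀) 1
    components-whole = (λ _ → zero) , onto , (λ u v um vm → mk⇔ (λ _ → connected C u v um vm) (λ _ → refl))
      where
      onto : ∀ j → ∃ λ u → u ∈ ⊤ × zero ≡ j
      onto zero = t₀ , ∈⊤ , refl

    bridge : IsBridge G₀ e
    bridge = 1 , components-whole , components-minus-e

    single-connected : Connected G₀ (single G₀ e)
    single-connected u v um vm = (e , x∈⁅x⁆ e , um , vm) ◅ ε

    -- one side of a separation of ⟨e⟩ would contain only the cut vertex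
    single-no-separating : NoSeparating G₀ (single G₀ e)
    single-no-separating v (Y₁ , Y₂ , Y₁⊆ , Y₂⊆ , _ , Y₁∩Y₂ , Y₁≥2 , Y₂≥2 , edges) = [ in-Y₁ , in-Y₂ ]′ (edges e (x∈⁅x⁆ e))
      where
      in-Y₁ : ¬ (inc G₀ e ⊆ Y₁)
      in-Y₁ sb = <⇒≱ (s≤s (⊆⁅⁆-card {p = Y₂} {v = v} (λ {y} m → subst (y ∈_) Y₁∩Y₂ (∈∩ (sb (Y₂⊆ m)) m)))) Y₂≥2
      in-Y₂ : ¬ (inc G₀ e ⊆ Y₂)
      in-Y₂ sb = <⇒≱ (s≤s (⊆⁅⁆-card {p = Y₁} {v = v} (λ {y} m → subst (y ∈_) Y₁∩Y₂ (∈∩ m (sb (Y₁⊆ m)))))) Y₁≥2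

    -- A subhypergraph S ⊒ ⟨e⟩ containing a vertex y ∉ e is separated at
    -- w = root y: the vertices of S with root w on one side, the others
    -- and w on the other.
    module SeparatedAtRoot (S : Sub G₀) (e⊑S : _⊑_ G₀ (single G₀ e) S) (y : Fin nv) (y∈S : y ∈ Ys S) (y∉e : y ∉ inc G₀ e) where
      w = root y

      Cw : Subset nv
      Cw = ⟦ (λ t → does (root t ≟ w)) ⟧

      Cw⁻ : ∀ {t} → t ∈ Cw → root t ≡ w
      Cw⁻ m = ∈⟦d⟧⁻ {d = λ t → root t ≟ w} m

      Cw⁺ : ∀ {t} → root t ≡ w → t ∈ Cw
      Cw⁺ e' = ∈⟦d⟧⁺ {d = λ t → root t ≟ w} e'

      e⊆S : inc G₀ e ⊆ Ys S
      e⊆S = proj₁ e⊑S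

      Y₁ = Ys S ∩ Cw
      Y₂ = (Ys S ∩ ∁ Cw) ∪ ⁅ w ⁆

      w∈Y₁ : w ∈ Y₁
      w∈Y₁ = ∈∩ (e⊆S (root∈e y)) (Cw⁺ (root-fix (root∈e y)))

      w∈Y₂ : w ∈ Y₂
      w∈Y₂ = ∈∪ʳ {p = Ys S ∩ ∁ Cw} (x∈⁅x⁆ w)

      another = ∃-other (inc G₀ e) w (≤-trans (n≤1+n 2) he)
      w' = proj₁ another
      w'≢w = proj₂ (proj₂ another)

      w'∈Y₂ : w' ∈ Y₂
      w'∈Y₂ = ∈∪ˡ (∈∩ (e⊆S (proj₁ (proj₂ another))) (x∉p⇒x∈∁p (λ m → w'≢w (trans (sym (root-fix (proj₁ (proj₂ another)))) (Cw⁻ m)))))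

      Y₂⊆S : Y₂ ⊆ Ys S
      Y₂⊆S m = [ ∈∩⁻ˡ , (λ z → subst (_∈ Ys S) (sym (∈⁅⁆ z)) (e⊆S (root∈e y))) ]′ (∈∪⁻ {p = Ys S ∩ ∁ Cw} m)

      union⊇ : ∀ t → t ∈ Ys S → t ∈ Y₁ ∪ Y₂
      union⊇ t tS = case-dec (t ∈? Cw) (λ z → ∈∪ˡ (∈∩ tS z)) (λ z → ∈∪ʳ {p = Y₁} (∈∪ˡ (∈∩ tS (x∉p⇒x∈∁p z))))

      union⊆ : ∀ t → t ∈ Y₁ ∪ Y₂ → t ∈ Ys S
      union⊆ t m = [ ∈∩⁻ˡ , Y₂⊆S ]′ (∈∪⁻ {p = Y₁} m)

      meet⊆ : ∀ t → t ∈ Y₁ ∩ Y₂ → t ∈ ⁅ w ⁆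
      meet⊆ t m = [ (λ z → ⊥-elim (x∈∁p⇒x∉p (∈∩⁻ʳ {p = Ys S} z) (∈∩⁻ʳ {p = Ys S} (∈∩⁻ˡ m)))) , (λ z → z) ]′
                    (∈∪⁻ {p = Ys S ∩ ∁ Cw} (∈∩⁻ʳ {p = Y₁} m))

      meet⊇ : ∀ t → t ∈ ⁅ w ⁆ → t ∈ Y₁ ∩ Y₂
      meet⊇ t m = subst (_∈ Y₁ ∩ Y₂) (sym (∈⁅⁆ m)) (∈∩ w∈Y₁ w∈Y₂)

      -- e lies in Y₂; any other edge lies within one component of G − e
      edge-side : ∀ f → f ∈ Fs S → (inc G₀ f ⊆ Y₁) ⊎ (inc G₀ f ⊆ Y₂)
      edge-side f fm with f ≟ e
      ... | yes refl = inj₂ (λ {t} tm → case-dec (t ≟ w)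
              (λ eq → ∈∪ʳ {p = Ys S ∩ ∁ Cw} (subst (_∈ ⁅ w ⁆) (sym eq) (x∈⁅x⁆ w)))
              (λ ne → ∈∪ˡ (∈∩ (e⊆S tm) (x∉p⇒x∈∁p (λ m → ne (trans (sym (root-fix tm)) (Cw⁻ m)))))))
      ... | no f≢e with ∃-member (inc G₀ f) (≤-trans (s≤s z≤n) (inc-≥2 G₀ f))
      ...   | a , af with root a ≟ w
      ...     | yes eq = inj₁ (λ {t} tm → ∈∩ (closed S f fm tm) (Cw⁺ (trans (same-root f≢e tm af) eq)))
      ...     | no neq = inj₂ (λ {t} tm → ∈∪ˡ (∈∩ (closed S f fm tm) (x∉p⇒x∈∁p (λ m → neq (trans (sym (same-root f≢e tm af)) (Cw⁻ m))))))

      separating : IsSeparating G₀ S w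
      separating = Y₁ , Y₂ , ∈∩⁻ˡ , Y₂⊆S , subset-ext union⊆ union⊇ , subset-ext meet⊆ meet⊇ ,
        card≥2 {p = Y₁} {x = y} {y = w} (∈∩ y∈S (Cw⁺ refl)) w∈Y₁ (λ eq → y∉e (subst (_∈ inc G₀ e) (sym eq) (root∈e y))) ,
        card≥2 {p = Y₂} w∈Y₂ w'∈Y₂ (λ eq → w'≢w (sym eq)) , edge-side

    single-maximal : ∀ S → _⊑_ G₀ (single G₀ e) S → Connected G₀ S → NoSeparating G₀ S →
      (Ys S ≡ Ys (single G₀ e)) × (Fs S ≡ Fs (single G₀ e))
    single-maximal S e⊑S _ nsep = subset-ext (λ t → in-e) (λ t m → proj₁ e⊑S m) , subset-ext edges (λ f m → proj₂ e⊑S m)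
      where
      in-e : ∀ {t} → t ∈ Ys S → t ∈ inc G₀ e
      in-e {t} tS = decidable-stable (t ∈? inc G₀ e) (λ t∉e → nsep (root t) (SeparatedAtRoot.separating S e⊑S t tS t∉e))
      -- another edge f of S would lie inside e and join two of its vertices
      edges : ∀ f → f ∈ Fs S → f ∈ ⁅ e ⁆
      edges f fm with f ≟ e
      ... | yes refl = x∈⁅x⁆ f
      ... | no f≢e with ∃-member (inc G₀ f) (≤-trans (s≤s z≤n) (inc-≥2 G₀ f))
      ...   | a , af with ∃-other (inc G₀ f) a (inc-≥2 G₀ f)
      ...     | b , bf , b≢a = ⊥-elim (b≢a (sym (joined⁻-in-e (in-e (closed S f fm af)) (in-e (closed S f fm bf))
                                                 ((f , ≢⇒∈∁⁅⁆ f≢e , af , bf) ◅ ε))))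

    block : IsBlock G₀ (single G₀ e)
    block = single-connected , single-no-separating , single-maximal

  -- two hyperedges with the same vertices would join two of them in G − e
  no-parallel : NoParallelHyperedges G₀
  no-parallel e e' e≢e' he he' same with ∃-member (inc G₀ e) (≤-trans (s≤s z≤n) he)
  ... | a , ae with ∃-other (inc G₀ e) a (inc-≥2 G₀ e)
  ...   | b , be , b≢a = b≢a (sym (Hyperedge.joined⁻-in-e e he ae be
            ((e' , ≢⇒∈∁⁅⁆ (λ z → e≢e' (sym z)) , subst (a ∈_) same ae , subst (b ∈_) same be) ◅ ε)))

  -- Part (d): G has no separating vertex, so (b) applies to every pair.

  μ-comm : ∀ u v → μ G₀ u v ≡ μ G₀ v u
  μ-comm u v = cong (λ S → ∣ ⟦ (λ e → does (inc G₀ e ≟ₛ S)) ⟧ ∣) (∪-comm ⁅ u ⁆ ⁅ v ⁆)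

  -- For an edge g = {a,b}, every x ∈ X_a is covered by M_g: otherwise its
  -- μ(b,a) neighbours in X_b would use the μ(b,a) − 1 other {a,b}-edges.
  covered : NoSeparating G₀ (whole G₀) → ∀ {a b g x} → a ≢ b → inc G₀ g ≡ ⁅ a ⁆ ∪ ⁅ b ⁆ → x ∈ X c a →
    ∃ λ h → φ₀ h ≡ g × x ∈ inc H₀ h
  covered nsep {a} {b} {g} {x} a≢b g≡ab xm = decidable-stable (FinP.any? (λ h → (φ₀ h ≟ g) ×-dec (x ∈? inc H₀ h))) uncovered
    where
    uncovered : ¬ ¬ (∃ λ h → φ₀ h ≡ g × x ∈ inc H₀ h)
    uncovered none = <⇒≱ (x∈p⇒∣p-x∣<∣p∣ {p = Mult b a} (Mult⁺ {g} (trans g≡ab (∪-comm ⁅ a ⁆ ⁅ b ⁆)))) (begin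
      μ G₀ b a                   ≡⟨ sym (part-b unc a (nsep a) b (λ z → a≢b (sym z)) x xm) ⟩
      ∣ N H₀ x ∩ X c b ∣         ≤⟨ neighbours-≤ (Mult b a - g) other-edge ⟩
      ∣ Mult b a - g ∣           ∎)
      where
      open ≤-Reasoning
      other-edge : ∀ y h → y ∈ N H₀ x ∩ X c b → inc H₀ h ≡ ⁅ x ⁆ ∪ ⁅ y ⁆ → φ₀ h ∈ Mult b a - g
      other-edge y h m eq = x∈p∧x≢y⇒x∈p-y (Mult⁺ (pair-image eq (X⁻ xm) (X⁻ (∈∩⁻ʳ {p = N H₀ x} m))))
                                          (λ z → none (h , z , subst (x ∈_) (sym eq) pairˡ))

  -- consequently M_g matches X_a injectively into X_b
  X-≤ : NoSeparating G₀ (whole G₀) → ∀ {a b g} → a ≢ b → inc G₀ g ≡ ⁅ a ⁆ ∪ ⁅ b ⁆ → ∣ X c a ∣ ≤ ∣ X c b ∣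
  X-≤ nsep {a} {b} {g} a≢b g≡ab = card-≤-injection (X c a) (X c b) (λ x y → ∃ λ h → φ₀ h ≡ g × x ∈ inc H₀ h × y ∈ inc H₀ h) partner injective
    where
    partner : ∀ x → x ∈ X c a → ∃ λ y → y ∈ X c b × ∃ λ h → φ₀ h ≡ g × x ∈ inc H₀ h × y ∈ inc H₀ h
    partner x xm with covered nsep a≢b g≡ab xm
    ... | h , hg , xh with meet-exists h b (subst (λ e → b ∈ inc G₀ e) (sym hg) (subst (b ∈_) (sym g≡ab) pairʳ))
    ...   | y , yh , py = y , X⁺ py , h , hg , xh , yh
    injective : ∀ x x' y → x ∈ X c a → x' ∈ X c a → (∃ λ h → φ₀ h ≡ g × x ∈ inc H₀ h × y ∈ inc H₀ h) →
      (∃ λ h → φ₀ h ≡ g × x' ∈ inc H₀ h × y ∈ inc H₀ h) → x ≡ x'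
    injective x x' y xm xm' (h , hg , xh , yh) (h' , hg' , xh' , yh') =
      meet-unique h a x x' (subst (λ e → a ∈ inc G₀ e) (sym hg) (subst (a ∈_) (sym g≡ab) pairˡ)) xh
        (subst (λ k → x' ∈ inc H₀ k) (sym (matching-unique h h' y (trans hg (sym hg')) yh yh')) xh') (X⁻ xm) (X⁻ xm')

  deg-edge : NoSeparating G₀ (whole G₀) → ∀ {a b g} → a ≢ b → inc G₀ g ≡ ⁅ a ⁆ ∪ ⁅ b ⁆ → deg G₀ a ≡ deg G₀ b
  deg-edge nsep {a} {b} {g} a≢b g≡ab = begin
    deg G₀ a       ≡⟨ sym (part-a unc a) ⟩
    ∣ X c a ∣      ≡⟨ ≤-antisym (X-≤ nsep a≢b g≡ab) (X-≤ nsep (λ z → a≢b (sym z)) (trans g≡ab (∪-comm ⁅ a ⁆ ⁅ b ⁆))) ⟩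
    ∣ X c b ∣      ≡⟨ part-a unc b ⟩
    deg G₀ b       ∎
    where open ≡-Reasoning

  deg-adjacent : NoSeparating G₀ (whole G₀) → ¬ (∃ λ e → 3 ≤ ∣ inc G₀ e ∣) → ∀ {a b} → Adj G₀ (whole G₀) a b → deg G₀ a ≡ deg G₀ b
  deg-adjacent nsep no-hyper {a} {b} (g , _ , ag , bg) with a ≟ b
  ... | yes refl = refl
  ... | no a≢b = deg-edge nsep a≢b (sym (⊆-card-≡ {p = ⁅ a ⁆ ∪ ⁅ b ⁆} pair⊆g (≤-trans |g|≤2 (card≥2 {p = ⁅ a ⁆ ∪ ⁅ b ⁆} pairˡ pairʳ a≢b))))
    where
    pair⊆g : ⁅ a ⁆ ∪ ⁅ b ⁆ ⊆ inc G₀ g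
    pair⊆g m = [ (λ z → subst (_∈ inc G₀ g) (sym z) ag) , (λ z → subst (_∈ inc G₀ g) (sym z) bg) ]′ (∈pair m)
    |g|≤2 : ∣ inc G₀ g ∣ ≤ 2
    |g|≤2 = ≤-pred (≰⇒> (λ z → no-hyper (g , z)))

  deg-joined : NoSeparating G₀ (whole G₀) → ¬ (∃ λ e → 3 ≤ ∣ inc G₀ e ∣) → ∀ {a b} → Joined G₀ (whole G₀) a b → deg G₀ a ≡ deg G₀ b
  deg-joined nsep no-hyper ε = refl
  deg-joined nsep no-hyper (st ◅ rest) = trans (deg-adjacent nsep no-hyper st) (deg-joined nsep no-hyper rest)

  -- G is regular: with a hyperedge e, G = ⟨e⟩ by maximality of the block
  -- ⟨e⟩ and every degree is 1; otherwise degrees agree along walks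
  regular : NoSeparating G₀ (whole G₀) → Regular G₀
  regular nsep u v with FinP.any? (λ e → 3 ≤? ∣ inc G₀ e ∣)
  ... | no no-hyper = deg-joined nsep no-hyper (connected C u v ∈⊤ ∈⊤)
  ... | yes (e , he) = trans (cong ∣_∣ (all-edges u)) (sym (cong ∣_∣ (all-edges v)))
    where
    G≡⟨e⟩ = Hyperedge.single-maximal e he (whole G₀) ((λ _ → ∈⊤) , (λ _ → ∈⊤)) (connected C) nsep
    all-edges : ∀ w → edgesAt G₀ w ≡ ⊤
    all-edges w = subset-ext (λ _ _ → ∈⊤) (λ f _ → ∈⟦d⟧⁺ {d = λ g → w ∈? inc G₀ g}
      (subst (λ g → w ∈ inc G₀ g) (sym (∈⁅⁆ (subst (f ∈_) (proj₂ G≡⟨e⟩) ∈⊤))) (subst (w ∈_) (proj₁ G≡⟨e⟩) ∈⊤)))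

  pair-shape : ∀ {a b h} → a ≢ b → inc H₀ h ⊆ (X c a ∪ X c b) → inc G₀ (φ₀ h) ≡ ⁅ a ⁆ ∪ ⁅ b ⁆
  pair-shape {a} {b} {h} a≢b sb = ⊆-card-≡ ⊆pair (≤-trans (∣pair∣≤2 a b) (inc-≥2 G₀ (φ₀ h)))
    where
    ⊆pair : inc G₀ (φ₀ h) ⊆ ⁅ a ⁆ ∪ ⁅ b ⁆
    ⊆pair {w} wm with meet-exists h w wm
    ... | t , th , pt = [ (λ z → subst (_∈ ⁅ a ⁆ ∪ ⁅ b ⁆) (trans (sym (X⁻ z)) pt) pairˡ)
                        , (λ z → subst (_∈ ⁅ a ⁆ ∪ ⁅ b ⁆) (trans (sym (X⁻ z)) pt) pairʳ) ]′ (∈∪⁻ {p = X c a} (sb th))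

  Incident : Fin nh → Subset nh → Subset (nE H₀)
  Incident x Y = ⟦ (λ f → does (inc H₀ f ⊆? Y) ∧ does (x ∈? inc H₀ f)) ⟧

  Incident⁻ : ∀ {x Y h} → h ∈ Incident x Y → (inc H₀ h ⊆ Y) × (x ∈ inc H₀ h)
  Incident⁻ {x} {Y} {h} m with ∧-true⁻ (∈⟦⟧⁻ {p = λ f → does (inc H₀ f ⊆? Y) ∧ does (x ∈? inc H₀ f)} m)
  ... | inside-Y , contains-x = from-does (inc H₀ h ⊆? Y) inside-Y , from-does (x ∈? inc H₀ h) contains-x

  Incident⁺ : ∀ {x Y h} → inc H₀ h ⊆ Y → x ∈ inc H₀ h → h ∈ Incident x Y
  Incident⁺ {x} {Y} {h} s m = ∈⟦⟧⁺ {p = λ f → does (inc H₀ f ⊆? Y) ∧ does (x ∈? inc H₀ f)}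
    (∧-true⁺ (dec-true (inc H₀ h ⊆? Y) s) (dec-true (x ∈? inc H₀ h) m))

  -- x ∈ X_a lies in exactly μ(a,b) edges of H[X_a ∪ X_b]: at most one per
  -- {a,b}-edge (a matching), and at least its μ(a,b) neighbours in X_b by (b)
  incident-count : NoSeparating G₀ (whole G₀) → ∀ {a b x} → a ≢ b → x ∈ X c a → ∣ Incident x (X c a ∪ X c b) ∣ ≡ μ G₀ a b
  incident-count nsep {a} {b} {x} a≢b xm = ≤-antisym at-most at-least
    where
    at-most : ∣ Incident x (X c a ∪ X c b) ∣ ≤ μ G₀ a b
    at-most = card-≤-injection (Incident x (X c a ∪ X c b)) (Mult a b) (λ h e → φ₀ h ≡ e)
      (λ h m → φ₀ h , Mult⁺ (pair-shape a≢b (proj₁ (Incident⁻ {x} {X c a ∪ X c b} m))) , refl)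
      (λ h h' e m m' r r' → matching-unique h h' x (trans r (sym r')) (proj₂ (Incident⁻ {x} {X c a ∪ X c b} m)) (proj₂ (Incident⁻ {x} {X c a ∪ X c b} m')))
    edge-to : ∀ y → y ∈ N H₀ x ∩ X c b → ∃ λ h → h ∈ Incident x (X c a ∪ X c b) × inc H₀ h ≡ ⁅ x ⁆ ∪ ⁅ y ⁆
    edge-to y m with N⁻ (∈∩⁻ˡ m)
    ... | h , eq = h , Incident⁺ (λ {t} tm → [ (λ z → ∈∪ˡ (subst (_∈ X c a) (sym z) xm))
                                           , (λ z → ∈∪ʳ {p = X c a} (subst (_∈ X c b) (sym z) (∈∩⁻ʳ {p = N H₀ x} m))) ]′ (∈pair (subst (t ∈_) eq tm)))
                                 (subst (x ∈_) (sym eq) pairˡ) , eq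
    -- the edge {x,y} determines y, since y ≠ x
    edge-determines : ∀ y y' h → y ∈ N H₀ x ∩ X c b → inc H₀ h ≡ ⁅ x ⁆ ∪ ⁅ y ⁆ → inc H₀ h ≡ ⁅ x ⁆ ∪ ⁅ y' ⁆ → y ≡ y'
    edge-determines y y' h m r r' with ∈pair (subst (y ∈_) (trans (sym r) r') pairʳ)
    ... | inj₂ y≡y' = y≡y'
    ... | inj₁ y≡x = ⊥-elim (a≢b (trans (sym (X⁻ xm)) (trans (cong π₀ (sym y≡x)) (X⁻ (∈∩⁻ʳ {p = N H₀ x} m)))))
    at-least : μ G₀ a b ≤ ∣ Incident x (X c a ∪ X c b) ∣
    at-least = begin
      μ G₀ a b                          ≡⟨ μ-comm a b ⟩
      μ G₀ b a                          ≡⟨ sym (part-b unc a (nsep a) b (λ z → a≢b (sym z)) x xm) ⟩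
      ∣ N H₀ x ∩ X c b ∣                ≤⟨ card-≤-injection (N H₀ x ∩ X c b) (Incident x (X c a ∪ X c b)) (λ y h → inc H₀ h ≡ ⁅ x ⁆ ∪ ⁅ y ⁆)
                                             edge-to (λ y y' h m _ r r' → edge-determines y y' h m r r') ⟩
      ∣ Incident x (X c a ∪ X c b) ∣    ∎
      where open ≤-Reasoning

  bipartite : NoSeparating G₀ (whole G₀) → ∀ u v → u ≢ v → RegularBipartite H₀ (μ G₀ u v) (X c u) (X c v)
  bipartite nsep u v u≢v = disjoint , edges-cross , regular-degree
    where
    disjoint : Empty (X c u ∩ X c v)
    disjoint (y , m) = u≢v (trans (sym (X⁻ (∈∩⁻ˡ m))) (X⁻ (∈∩⁻ʳ {p = X c u} m)))
    edges-cross : ∀ f → inc H₀ f ⊆ (X c u ∪ X c v) → (∣ inc H₀ f ∣ ≡ 2) × (∣ inc H₀ f ∩ X c u ∣ ≡ 1) × (∣ inc H₀ f ∩ X c v ∣ ≡ 1)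
    edges-cross f sb = size , one-in-u , one-in-v
      where
      φf≡uv = pair-shape u≢v sb
      one-in-u : ∣ inc H₀ f ∩ X c u ∣ ≡ 1
      one-in-u = φ-meets c f u (subst (u ∈_) (sym φf≡uv) pairˡ)
      one-in-v : ∣ inc H₀ f ∩ X c v ∣ ≡ 1
      one-in-v = φ-meets c f v (subst (v ∈_) (sym φf≡uv) pairʳ)
      sides-disjoint : Empty ((inc H₀ f ∩ X c u) ∩ (inc H₀ f ∩ X c v))
      sides-disjoint (y , m) = disjoint (y , ∈∩ (∈∩⁻ʳ {p = inc H₀ f} (∈∩⁻ˡ m)) (∈∩⁻ʳ {p = inc H₀ f} (∈∩⁻ʳ {p = inc H₀ f ∩ X c u} m)))
      split : inc H₀ f ≡ (inc H₀ f ∩ X c u) ∪ (inc H₀ f ∩ X c v)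
      split = subset-ext (λ t tm → [ (λ z → ∈∪ˡ (∈∩ tm z)) , (λ z → ∈∪ʳ {p = inc H₀ f ∩ X c u} (∈∩ tm z)) ]′ (∈∪⁻ {p = X c u} (sb tm)))
                         (λ t m → [ ∈∩⁻ˡ , ∈∩⁻ˡ ]′ (∈∪⁻ {p = inc H₀ f ∩ X c u} m))
      size : ∣ inc H₀ f ∣ ≡ 2
      size = begin
        ∣ inc H₀ f ∣                                           ≡⟨ cong ∣_∣ split ⟩
        ∣ (inc H₀ f ∩ X c u) ∪ (inc H₀ f ∩ X c v) ∣           ≡⟨ card-disjoint-∪ (inc H₀ f ∩ X c u) (inc H₀ f ∩ X c v) sides-disjoint ⟩
        ∣ inc H₀ f ∩ X c u ∣ + ∣ inc H₀ f ∩ X c v ∣           ≡⟨ cong₂ _+_ one-in-u one-in-v ⟩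
        2                                                      ∎
        where open ≡-Reasoning
    regular-degree : ∀ x → x ∈ (X c u ∪ X c v) → ∣ Incident x (X c u ∪ X c v) ∣ ≡ μ G₀ u v
    regular-degree x m with ∈∪⁻ {p = X c u} m
    ... | inj₁ x∈u = incident-count nsep u≢v x∈u
    ... | inj₂ x∈v = begin
      ∣ Incident x (X c u ∪ X c v) ∣   ≡⟨ cong (λ Y → ∣ Incident x Y ∣) (∪-comm (X c u) (X c v)) ⟩
      ∣ Incident x (X c v ∪ X c u) ∣   ≡⟨ incident-count nsep (λ w → u≢v (sym w)) x∈v ⟩
      μ G₀ v u                         ≡⟨ μ-comm v u ⟩
      μ G₀ u v                         ∎
      where open ≡-Reasoning

proposition5 : (C : Configuration) → DegreeFeasible C → Uncolorable C →
    let G' = G C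
        c = cov C
    in
    -- (a)
    (∀ v → ∣ X c v ∣ ≡ deg G' v)
    -- (b)
    × (∀ z → ¬ IsSeparating G' (whole G') z → ∀ v → v ≢ z →
         ∀ x → x ∈ X c z → ∣ N (H c) x ∩ X c v ∣ ≡ μ G' v z)
    -- (c)
    × ((∀ e → IsHyperedge G' e → IsBridge G' e × IsBlock G' (single G' e))
       × NoParallelHyperedges G')
    -- (d)
    × (NoSeparating G' (whole G') →
         Regular G' × (∀ u v → u ≢ v →
           RegularBipartite (H c) (μ G' u v) (X c u) (X c v)))
    -- (e)
    × (∀ v → ∃ λ T → Independent (H c) T × (∀ u → u ≢ v → ∣ T ∩ X c u ∣ ≡ 1))
proposition5 C df unc =
    part-a unc
  , part-b unc
  , ((λ e he → Hyperedge.bridge e he , Hyperedge.block e he) , no-parallel)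
  , (λ nsep → regular nsep , bipartite nsep)
  , part-e
  where
  open Colouring C df
  open Structure C df unc
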